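{- The patterns $1234$ and $1324$ are strongly $1$-Wilf-equivalent, i.e. for every $n\ge 1$ and every $j\in[n]$, the number of partial permutations of length $n$ with exactly one hole, located at position $j$, that avoid $1234$ equals the number of such partial permutations that avoid $1324$.
   Context: A partial permutation of length $n$ with one hole is a sequence $\pi_1\cdots\pi_n$ in which each of $1,\dots,n-1$ appears exactly once and the remaining entry is a hole symbol $\diamond$. A permutation $\sigma$ of $[n]$ is an extension of $\pi$ if the standardization (order-preserving relabeling by $1,2,\dots$) of the restriction of $\sigma$ to the non-hole positions equals the restriction of $\pi$ to those positions. $\pi$ avoids a pattern $p$ if every extension of $\pi$ avoids $p$ in the classical sense. -}

module Defs where

-- Everything is computed with Booleans over explicit finite enumerations,
-- so that "the number of ..." is literally the length of a filtered list.
-- Conventions: values are 1-based (as in the paper); positions are 1-based.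

open import Data.Bool using (Bool; true; false; _∧_; _∨_; not; if_then_else_)
open import Data.Nat using (ℕ; zero; suc; _+_; _≡ᵇ_; _<ᵇ_)
open import Data.Maybe using (Maybe; just; nothing)
open import Data.Bool.ListAction using (all; any)
open import Data.List using (List; []; _∷_; map; length; filterᵇ;
  concatMap; applyUpTo; sum; zip; mapMaybe)
open import Data.Product using (_×_; _,_)

range1 : ℕ → List ℕ
range1 n = applyUpTo suc n

words : {A : Set} → List A → ℕ → List (List A)
words alph zero    = [] ∷ []
words alph (suc n) = concatMap (λ a → map (a ∷_) (words alph n)) alph

occ : {A : Set} → (A → A → Bool) → A → List A → ℕ
occ eq a xs = length (filterᵇ (eq a) xs)

_==L_ : List ℕ → List ℕ → Bool
[]       ==L []       = true
(x ∷ xs) ==L (y ∷ ys) = (x ≡ᵇ y) ∧ (xs ==L ys)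
_        ==L _        = false

isPerm : ℕ → List ℕ → Bool
isPerm n σ = (length σ ≡ᵇ n) ∧ all (λ k → occ _≡ᵇ_ k σ ≡ᵇ 1) (range1 n)

perms : ℕ → List (List ℕ)
perms n = filterᵇ (isPerm n) (words (range1 n) n)

st : List ℕ → List ℕ
st xs = map (λ x → suc (length (filterᵇ (λ y → y <ᵇ x) xs))) xs

subseqs : {A : Set} → List A → List (List A)
subseqs []       = [] ∷ []
subseqs (x ∷ xs) = let r = subseqs xs in map (x ∷_) r Data.List.++ r

contains : List ℕ → List ℕ → Bool
contains p σ = any (λ s → (length s ≡ᵇ length p) ∧ (st s ==L p)) (subseqs σ)

avoidsPerm : List ℕ → List ℕ → Bool
avoidsPerm p σ = not (contains p σ)

-- partial permutations: words over {◇} ∪ ℕ, with ◇ = nothing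
PWord : Set
PWord = List (Maybe ℕ)

eqM : Maybe ℕ → Maybe ℕ → Bool
eqM nothing  nothing  = true
eqM (just a) (just b) = a ≡ᵇ b
eqM _        _        = false

isPartialPerm1 : ℕ → PWord → Bool
isPartialPerm1 n π =
  (length π ≡ᵇ n) ∧ (occ eqM nothing π ≡ᵇ 1)
  ∧ all (λ k → occ eqM (just k) π ≡ᵇ 1) (range1 (n Data.Nat.∸ 1))

partialPerms1 : ℕ → List PWord
partialPerms1 n =
  filterᵇ (isPartialPerm1 n) (words (nothing ∷ map just (range1 (n Data.Nat.∸ 1))) n)

holeAt : ℕ → PWord → Bool
holeAt j          []             = false
holeAt zero       (_ ∷ _)        = false
holeAt (suc zero) (nothing ∷ _)  = true
holeAt (suc zero) (just _ ∷ _)   = false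
holeAt (suc (suc j)) (_ ∷ π)     = holeAt (suc j) π

restrictTo : PWord → List ℕ → List ℕ
restrictTo π σ = mapMaybe (λ { (nothing , _) → nothing ; (just _ , s) → just s }) (zip π σ)

filled : PWord → List ℕ
filled π = mapMaybe (λ m → m) π

isExtension : PWord → List ℕ → Bool
isExtension π σ = isPerm (length π) σ ∧ (st (restrictTo π σ) ==L filled π)

avoidsPartial : List ℕ → PWord → Bool
avoidsPartial p π = all (λ σ → not (isExtension π σ) ∨ avoidsPerm p σ) (perms (length π))

count1 : List ℕ → ℕ → ℕ → ℕ
count1 p n j = length (filterᵇ (λ π → holeAt j π ∧ avoidsPartial p π) (partialPerms1 n))

-- A partial permutation with its hole at position j is A ◇ B, where A and B are the words to the
-- left and to the right of the hole. A ◇ B avoids 1234 iff A and B avoid 123, no value of A lies below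
-- an ascent of B and no ascent of A lies below a value of B; it avoids 1324 iff A avoids 132, B avoids
-- 213 and the same two crossing conditions hold (necessity by giving the hole a suitable value,
-- sufficiency by locating a potential occurrence relative to the hole). The crossing conditions only
-- see the values of A, those values of A preceded by a smaller one, the values of B, and those values
-- of B followed by a larger one. The Simion–Schmidt bijection keeps the left-to-right minima in place
-- and refills the other positions with the same values (largest remaining value first for 123-avoiders,
-- least value above the current minimum for 132-avoiders), so it preserves exactly these data. Applied
-- to A, and to B read backwards in the reversed order, it maps the partial permutations of either kind
-- onto those of the other.

module Submission where

open import Defs
open import Level using (0ℓ)
open import Function using (id; _∘_; Equivalence)
open import Data.Bool using (Bool; true; false; _∧_; _∨_; not; T; T?)
open import Data.Bool.ListAction using (all)
open import Data.Empty using (⊥; ⊥-elim)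
open import Data.Unit using (tt)
open import Data.Bool.Properties using (T-∧; T-≡)
open import Data.Maybe using (Maybe; just; nothing)
open import Data.Maybe.Properties using (just-injective)
open import Data.Nat using (ℕ; zero; suc; _+_; _∸_; _≤_; _<_; s≤s; z≤n; _≡ᵇ_; _<ᵇ_; _<?_; _≟_)
open import Data.Nat.Properties
  using (≤-refl; ≤-reflexive; ≤-trans; ≤-pred; ≤-antisym; n≤1+n; n<1+n; suc-injective; <⇒≢; >⇒≢
      ; <⇒≱; <⇒≯; ≮⇒≥; <-≤-trans; ≤-<-trans; <-trans; ≤⇒≯; <-irrefl; <-cmp; +-suc; +-comm; ≡ᵇ⇒≡
      ; ≡⇒≡ᵇ; <ᵇ⇒<; <⇒<ᵇ; <-isStrictTotalOrder)
open import Data.Product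
  using (Σ-syntax; ∃-syntax; _×_; _,_; proj₁; proj₂) renaming (swap to ×-swap)
open import Data.Sum using (_⊎_; inj₁; inj₂)
open import Data.List
  using (List; []; _∷_; _++_; length; map; filter; filterᵇ; reverse; catMaybes; fromMaybe
      ; concatMap)
open import Data.List.Properties
  using (++-identityʳ; reverse-involutive; filter-accept; filter-++; length-map; map-∘; map-id-local
      ; map-cong; map-++; length-++; length-++-sucʳ; ∷-injective; ∷-injectiveʳ)
open import Data.List.Membership.Propositional using (_∈_; _∉_; find; lose)
open import Data.List.Membership.DecPropositional _≟_ using (_∈?_)
open import Data.List.Membership.Propositional.Properties
  using (∈-filter⁺; ∈-filter⁻; ∈-map⁺; ∈-map⁻; ∈-++⁺ˡ; ∈-++⁺ʳ; ∈-++⁻; ∈-∃++; ∈-applyUpTo⁺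
      ; ∈-applyUpTo⁻; ∈-concatMap⁺; ∈-concatMap⁻)
open import Data.List.Relation.Unary.Any using (here; there)
open import Data.List.Relation.Unary.All using (All; []; _∷_)
import Data.List.Relation.Unary.All as All
import Data.List.Relation.Unary.All.Properties as AllP
import Data.List.Relation.Unary.Any as Any
import Data.List.Relation.Unary.Any.Properties as AnyP
open import Data.List.Relation.Unary.Unique.Propositional using (Unique; []; _∷_)
import Data.List.Relation.Unary.Unique.Propositional.Properties as Unique
open import Data.List.Relation.Binary.Sublist.Propositional
  using (_⊆_; []; _∷_; _∷ʳ_; ⊆-refl; ⊆-trans; lookup; from∈; minimum)
import Data.List.Relation.Binary.Sublist.Propositional.Properties as ⊆
open import Data.List.Relation.Binary.Permutation.Propositional
  using (_↭_; ↭-refl; ↭-reflexive; ↭-sym; ↭-trans; prep; swap)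
open import Data.List.Relation.Binary.Permutation.Propositional.Properties
  using (shift; drop-∷; ∈-resp-↭; ↭-length; filter-↭; ↭-empty-inv; ++⁺ˡ; ↭-reverse; All-resp-↭)
import Data.List.Relation.Binary.Permutation.Propositional.Properties as ↭
open import Relation.Nullary using (¬_; Dec; yes; no)
open import Relation.Binary using (Rel; IsStrictTotalOrder; TotalOrder; tri<; tri≈; tri>)
import Relation.Binary.Construct.StrictToNonStrict as StrictToNonStrict
import Relation.Binary.Construct.Flip.EqAndOrd as Flip
import Data.List.Extrema as Extrema
open import Relation.Binary.PropositionalEquality
  using (_≡_; _≢_; refl; sym; trans; cong; cong₂; subst; subst₂; module ≡-Reasoning)

head-∈ : ∀ {X : Set} {x : X} {xs ys} → (x ∷ xs) ⊆ ys → x ∈ ys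
head-∈ p = lookup p (here refl)

⊆-reverse : ∀ {X : Set} {xs ys : List X} → xs ⊆ reverse ys → reverse xs ⊆ ys
⊆-reverse {ys = ys} s = subst (_ ⊆_) (reverse-involutive ys) (⊆.reverse⁺ s)

⊆-++-split : ∀ {X : Set} {s : List X} xs ys → s ⊆ xs ++ ys →
             ∃[ s₁ ] ∃[ s₂ ] s ≡ s₁ ++ s₂ × s₁ ⊆ xs × s₂ ⊆ ys
⊆-++-split [] ys p = [] , _ , refl , [] , p
⊆-++-split (x ∷ xs) ys (.x ∷ʳ p) with ⊆-++-split xs ys p
... | s₁ , s₂ , refl , p₁ , p₂ = s₁ , s₂ , refl , x ∷ʳ p₁ , p₂
⊆-++-split (x ∷ xs) ys (refl ∷ p) with ⊆-++-split xs ys p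
... | s₁ , s₂ , refl , p₁ , p₂ = x ∷ s₁ , s₂ , refl , refl ∷ p₁ , p₂

++-injective : ∀ {X : Set} (xs ys : List X) {us vs} →
               length xs ≡ length ys → xs ++ us ≡ ys ++ vs → xs ≡ ys × us ≡ vs
++-injective [] [] _ eq = refl , eq
++-injective (x ∷ xs) (y ∷ ys) len eq with ∷-injective eq
... | refl , eq′ = let xs≡ys , us≡vs = ++-injective xs ys (suc-injective len) eq′ in cong (x ∷_) xs≡ys , us≡vs

remove : ℕ → List ℕ → List ℕ
remove p [] = []
remove p (x ∷ xs) with p ≟ x
... | yes _ = xs
... | no  _ = x ∷ remove p xs

remove-↭ : ∀ {p P} → p ∈ P → P ↭ p ∷ remove p P
remove-↭ {p} {x ∷ xs} i with p ≟ x
remove-↭ {p} {x ∷ xs} i           | yes refl = ↭-refl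
remove-↭ {p} {x ∷ xs} (here refl) | no p≢x   = ⊥-elim (p≢x refl)
remove-↭ {p} {x ∷ xs} (there i)   | no _     = ↭-trans (prep x (remove-↭ i)) (swap x p ↭-refl)

remove-∉ : ∀ {p} P → p ∉ P → remove p P ≡ P
remove-∉ [] _ = refl
remove-∉ {p} (x ∷ xs) p∉ with p ≟ x
... | yes refl = ⊥-elim (p∉ (here refl))
... | no  _    = cong (x ∷_) (remove-∉ xs (p∉ ∘ there))

∈-remove⁻ : ∀ {p y} P → y ∈ remove p P → y ∈ P
∈-remove⁻ {p} (x ∷ xs) i with p ≟ x
∈-remove⁻ (x ∷ xs) i         | yes _ = there i
∈-remove⁻ (x ∷ xs) (here e)  | no  _ = here e
∈-remove⁻ (x ∷ xs) (there i) | no  _ = there (∈-remove⁻ xs i)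

remove-head : ∀ x xs → remove x (x ∷ xs) ≡ xs
remove-head x xs with x ≟ x
... | yes _   = refl
... | no  x≢x = ⊥-elim (x≢x refl)

remove-↭-cong : ∀ p {P P'} → P ↭ P' → remove p P ↭ remove p P'
remove-↭-cong p {P} {P'} r with p ∈? P
... | yes i  = drop-∷ (↭-trans (↭-sym (remove-↭ i)) (↭-trans r (remove-↭ (∈-resp-↭ r i))))
... | no  p∉ rewrite remove-∉ P p∉ | remove-∉ P' (p∉ ∘ ∈-resp-↭ (↭-sym r)) = r

Occurs : (ℕ → ℕ → ℕ → Set) → List ℕ → Set
Occurs R xs = ∃[ a ] ∃[ b ] ∃[ c ] (a ∷ b ∷ c ∷ []) ⊆ xs × R a b c

module _ {R : ℕ → ℕ → ℕ → Set} where

  Occurs-mono : ∀ {xs ys} → xs ⊆ ys → Occurs R xs → Occurs R ys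
  Occurs-mono p (a , b , c , s , r) = a , b , c , ⊆-trans s p , r

  ¬Occurs-fromMaybe : ∀ μ → ¬ Occurs R (fromMaybe μ)
  ¬Occurs-fromMaybe nothing  (_ , _ , _ , () , _)
  ¬Occurs-fromMaybe (just m) (_ , _ , _ , _ ∷ʳ () , _)
  ¬Occurs-fromMaybe (just m) (_ , _ , _ , refl ∷ () , _)

  Occurs-reverse : ∀ {S : ℕ → ℕ → ℕ → Set} {xs} → (∀ {a b c} → R c b a → S a b c) →
                   Occurs R (reverse xs) → Occurs S xs
  Occurs-reverse f (a , b , c , s , r) = c , b , a , ⊆-reverse s , f r

-- The Simion–Schmidt bijection
module SimionSchmidt {_≺_ : Rel ℕ 0ℓ} (≺-isStrictTotalOrder : IsStrictTotalOrder _≡_ _≺_) where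

  open IsStrictTotalOrder ≺-isStrictTotalOrder
    using (compare; irrefl) renaming (trans to ≺-trans; _<?_ to _≺?_)
  open StrictToNonStrict _≡_ _≺_ using () renaming (_≤_ to _≼_)

  ≼-totalOrder : TotalOrder 0ℓ 0ℓ 0ℓ
  ≼-totalOrder = record { isTotalOrder = StrictToNonStrict.isTotalOrder _≡_ _≺_ ≺-isStrictTotalOrder }

  open TotalOrder ≼-totalOrder using () renaming (refl to ≼-refl; antisym to ≼-antisym)
  open Extrema ≼-totalOrder
    using (max; min; ⊥≤max; xs≤max; max≤v⁺; min≤⊤; min≤xs; v≤min⁺; argmax-all; argmin-all)

  ≺-irrefl : ∀ {x} → ¬ x ≺ x
  ≺-irrefl = irrefl refl

  ≼⇒≯ : ∀ {x y} → x ≼ y → ¬ y ≺ x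
  ≼⇒≯ (inj₁ x≺y) y≺x = ≺-irrefl (≺-trans x≺y y≺x)
  ≼⇒≯ (inj₂ refl) = ≺-irrefl

  ≯⇒≼ : ∀ {x y} → ¬ y ≺ x → x ≼ y
  ≯⇒≼ {x} {y} y⊀x with compare x y
  ... | tri< x≺y _ _ = inj₁ x≺y
  ... | tri≈ _ x≡y _ = inj₂ x≡y
  ... | tri> _ _ y≺x = ⊥-elim (y⊀x y≺x)

  ≼-≺-trans : ∀ {x y z} → x ≼ y → y ≺ z → x ≺ z
  ≼-≺-trans (inj₁ x≺y) y≺z = ≺-trans x≺y y≺z
  ≼-≺-trans (inj₂ refl) y≺z = y≺z

  Has123 Has132 : List ℕ → Set
  Has123 = Occurs (λ a b c → a ≺ b × b ≺ c)
  Has132 = Occurs (λ a b c → a ≺ c × c ≺ b)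

  RisesTo : List ℕ → ℕ → Set
  RisesTo xs y = ∃[ x ] (x ∷ y ∷ []) ⊆ xs × x ≺ y

  -- μ is the running minimum of the prefix read so far (nothing for the empty prefix).
  Above : Maybe ℕ → ℕ → Set
  Above nothing  y = ⊥
  Above (just m) y = m ≺ y

  above? : ∀ μ y → Dec (Above μ y)
  above? nothing  y = no λ ()
  above? (just m) y = m ≺? y

  Above-≼ : ∀ μ {y z} → Above μ y → y ≼ z → Above μ z
  Above-≼ (just m) m≺y (inj₁ y≺z) = ≺-trans m≺y y≺z
  Above-≼ (just m) m≺y (inj₂ refl) = m≺y

  Above-newMin : ∀ μ {x y} → ¬ Above μ x → Above μ y → Above (just x) y
  Above-newMin (just m) m⊀x m≺y = ≼-≺-trans (≯⇒≼ m⊀x) m≺y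

  skeleton : Maybe ℕ → List ℕ → List (Maybe ℕ)
  skeleton μ [] = []
  skeleton μ (x ∷ xs) with above? μ x
  ... | yes _ = nothing ∷ skeleton μ xs
  ... | no  _ = just x ∷ skeleton (just x) xs

  nonMinima : Maybe ℕ → List ℕ → List ℕ
  nonMinima μ [] = []
  nonMinima μ (x ∷ xs) with above? μ x
  ... | yes _ = x ∷ nonMinima μ xs
  ... | no  _ = nonMinima (just x) xs

  module _ (μ : Maybe ℕ) {x : ℕ} (xs : List ℕ) where

    skeleton-above : Above μ x → skeleton μ (x ∷ xs) ≡ nothing ∷ skeleton μ xs
    skeleton-above μ≺x with above? μ x
    ... | yes _   = refl
    ... | no  μ⊀x = ⊥-elim (μ⊀x μ≺x)

    nonMinima-above : Above μ x → nonMinima μ (x ∷ xs) ≡ x ∷ nonMinima μ xs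
    nonMinima-above μ≺x with above? μ x
    ... | yes _   = refl
    ... | no  μ⊀x = ⊥-elim (μ⊀x μ≺x)

    skeleton-newMin : ¬ Above μ x → skeleton μ (x ∷ xs) ≡ just x ∷ skeleton (just x) xs
    skeleton-newMin μ⊀x with above? μ x
    ... | yes μ≺x = ⊥-elim (μ⊀x μ≺x)
    ... | no  _   = refl

    nonMinima-newMin : ¬ Above μ x → nonMinima μ (x ∷ xs) ≡ nonMinima (just x) xs
    nonMinima-newMin μ⊀x with above? μ x
    ... | yes μ≺x = ⊥-elim (μ⊀x μ≺x)
    ... | no  _   = refl

  nonMinima-⊆ : ∀ μ xs → nonMinima μ xs ⊆ xs
  nonMinima-⊆ μ [] = []
  nonMinima-⊆ μ (x ∷ xs) with above? μ x
  ... | yes _ = refl ∷ nonMinima-⊆ μ xs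
  ... | no  _ = x ∷ʳ nonMinima-⊆ (just x) xs

  ↭-minima++nonMinima : ∀ μ xs → xs ↭ catMaybes (skeleton μ xs) ++ nonMinima μ xs
  ↭-minima++nonMinima μ [] = ↭-refl
  ↭-minima++nonMinima μ (x ∷ xs) with above? μ x
  ... | yes _ = ↭-trans (prep x (↭-minima++nonMinima μ xs)) (↭-sym (shift x (catMaybes (skeleton μ xs)) _))
  ... | no  _ = prep x (↭-minima++nonMinima (just x) xs)

  ↭-from-skeleton : ∀ μ xs ys → skeleton μ xs ≡ skeleton μ ys → nonMinima μ xs ↭ nonMinima μ ys → xs ↭ ys
  ↭-from-skeleton μ xs ys sk≡ nm↭ =
    ↭-trans (↭-minima++nonMinima μ xs)
      (↭-trans (subst (λ sk → _ ↭ catMaybes sk ++ _) sk≡ (++⁺ˡ (catMaybes (skeleton μ xs)) nm↭))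
               (↭-sym (↭-minima++nonMinima μ ys)))

  ∈-nonMinima⁻ : ∀ μ xs {y} → y ∈ nonMinima μ xs → (Above μ y × y ∈ xs) ⊎ RisesTo xs y
  ∈-nonMinima⁻ μ (x ∷ xs) i with above? μ x
  ∈-nonMinima⁻ μ (x ∷ xs) (here refl) | yes μ≺x = inj₁ (μ≺x , here refl)
  ∈-nonMinima⁻ μ (x ∷ xs) (there i)   | yes _ with ∈-nonMinima⁻ μ xs i
  ... | inj₁ (μ≺y , y∈) = inj₁ (μ≺y , there y∈)
  ... | inj₂ (z , s , z≺y) = inj₂ (z , x ∷ʳ s , z≺y)
  ∈-nonMinima⁻ μ (x ∷ xs) i | no _ with ∈-nonMinima⁻ (just x) xs i
  ... | inj₁ (x≺y , y∈) = inj₂ (x , refl ∷ from∈ y∈ , x≺y)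
  ... | inj₂ (z , s , z≺y) = inj₂ (z , x ∷ʳ s , z≺y)

  ∈-nonMinima⁺ : ∀ μ xs {y} → (Above μ y × y ∈ xs) ⊎ RisesTo xs y → y ∈ nonMinima μ xs
  ∈-nonMinima⁺ μ [] (inj₁ (_ , ()))
  ∈-nonMinima⁺ μ [] (inj₂ (_ , () , _))
  ∈-nonMinima⁺ μ (x ∷ xs) h with above? μ x
  ∈-nonMinima⁺ μ (x ∷ xs) (inj₁ (_ , here refl))    | yes _ = here refl
  ∈-nonMinima⁺ μ (x ∷ xs) (inj₁ (μ≺y , there y∈))   | yes _ = there (∈-nonMinima⁺ μ xs (inj₁ (μ≺y , y∈)))
  ∈-nonMinima⁺ μ (x ∷ xs) (inj₂ (z , _ ∷ʳ s , z≺y)) | yes _ = there (∈-nonMinima⁺ μ xs (inj₂ (z , s , z≺y)))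
  ∈-nonMinima⁺ μ (x ∷ xs) (inj₂ (x , refl ∷ s , x≺y)) | yes μ≺x =
    there (∈-nonMinima⁺ μ xs (inj₁ (Above-≼ μ μ≺x (inj₁ x≺y) , head-∈ s)))
  ∈-nonMinima⁺ μ (x ∷ xs) (inj₁ (μ≺x , here refl))  | no μ⊀x = ⊥-elim (μ⊀x μ≺x)
  ∈-nonMinima⁺ μ (x ∷ xs) (inj₁ (μ≺y , there y∈))   | no μ⊀x =
    ∈-nonMinima⁺ (just x) xs (inj₁ (Above-newMin μ μ⊀x μ≺y , y∈))
  ∈-nonMinima⁺ μ (x ∷ xs) (inj₂ (z , _ ∷ʳ s , z≺y)) | no _ = ∈-nonMinima⁺ (just x) xs (inj₂ (z , s , z≺y))
  ∈-nonMinima⁺ μ (x ∷ xs) (inj₂ (x , refl ∷ s , x≺y)) | no _ = ∈-nonMinima⁺ (just x) xs (inj₁ (x≺y , head-∈ s))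

  countAbove : ℕ → List ℕ → ℕ
  countAbove t = length ∘ filter (t ≺?_)

  countAbove-↭ : ∀ t {P Q} → P ↭ Q → countAbove t P ≡ countAbove t Q
  countAbove-↭ t r = ↭-length (filter-↭ (t ≺?_) r)

  countAbove-∷ : ∀ {t x} xs → t ≺ x → countAbove t (x ∷ xs) ≡ suc (countAbove t xs)
  countAbove-∷ xs t≺x = cong length (filter-accept (_ ≺?_) t≺x)

  countAbove-pos : ∀ t xs → 1 ≤ countAbove t xs → ∃[ y ] y ∈ xs × t ≺ y
  countAbove-pos t (x ∷ xs) pos with t ≺? x
  ... | yes t≺x = x , here refl , t≺x
  ... | no  _ with countAbove-pos t xs pos
  ... | y , y∈ , t≺y = y , there y∈ , t≺y

  -- P can refill the non-minimal positions whose original values were Q; the counting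
  -- condition guarantees a value above the running minimum whenever one is needed.
  record Fillable (μ : Maybe ℕ) (Q P : List ℕ) : Set where
    constructor fillable
    field
      same-length : length P ≡ length Q
      dominates   : ∀ t → ¬ Above μ t → countAbove t Q ≤ countAbove t P

  Fillable-refl : ∀ μ Q → Fillable μ Q Q
  Fillable-refl μ Q = fillable refl λ _ _ → ≤-refl

  Fillable-[] : ∀ {μ P} → Fillable μ [] P → P ≡ []
  Fillable-[] {P = []} _ = refl

  Fillable-newMin : ∀ μ {x Q P} → ¬ Above μ x → Fillable μ Q P → Fillable (just x) Q P
  Fillable-newMin μ μ⊀x (fillable len dom) = fillable len λ t x⊀t → dom t (x⊀t ∘ Above-newMin μ μ⊀x)

  Fillable-∷-∃ : ∀ μ {x Q P} → Above μ x → Fillable μ (x ∷ Q) P → ∃[ y ] y ∈ P × Above μ y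
  Fillable-∷-∃ (just m) {Q = Q} {P} m≺x (fillable _ dom) =
    countAbove-pos m P (≤-trans (subst (1 ≤_) (sym (countAbove-∷ Q m≺x)) (s≤s z≤n)) (dom m ≺-irrefl))

  Fillable-∷-remove : ∀ μ {x p Q P} → Above μ x → Fillable μ (x ∷ Q) P → p ∈ P → Above μ p →
                      Fillable μ Q (remove p P)
  Fillable-∷-remove μ {x} {p} {Q} {P} μ≺x (fillable len dom) p∈ μ≺p =
    fillable (suc-injective (trans (sym (↭-length (remove-↭ p∈))) len)) dom′
    where
    dom′ : ∀ t → ¬ Above μ t → countAbove t Q ≤ countAbove t (remove p P)
    dom′ t μ⊀t = ≤-pred (subst₂ _≤_ (countAbove-∷ Q t≺x) countP (dom t μ⊀t))
      where
      t≺x : t ≺ x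
      t≺x = Above-newMin μ μ⊀t μ≺x
      countP : countAbove t P ≡ suc (countAbove t (remove p P))
      countP = trans (countAbove-↭ t (remove-↭ p∈)) (countAbove-∷ (remove p P) (Above-newMin μ μ⊀t μ≺p))

  record FillingRule : Set where
    field
      choose       : Maybe ℕ → List ℕ → ℕ
      choose-valid : ∀ μ {P y} → y ∈ P → Above μ y → choose μ P ∈ P × Above μ (choose μ P)
      choose-↭     : ∀ μ {P P'} → P ↭ P' → choose μ P ≡ choose μ P'

  module Filling (rule : FillingRule) where

    open FillingRule rule

    fill : Maybe ℕ → List (Maybe ℕ) → List ℕ → List ℕ
    fill μ [] P = []
    fill μ (just x ∷ sk) P = x ∷ fill (just x) sk P
    fill μ (nothing ∷ sk) P = choose μ P ∷ fill μ sk (remove (choose μ P) P)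

    fill-↭ : ∀ μ sk {P P'} → P ↭ P' → fill μ sk P ≡ fill μ sk P'
    fill-↭ μ [] r = refl
    fill-↭ μ (just x ∷ sk) r = cong (x ∷_) (fill-↭ (just x) sk r)
    fill-↭ μ (nothing ∷ sk) {P} {P'} r rewrite choose-↭ μ r =
      cong (choose μ P' ∷_) (fill-↭ μ sk (remove-↭-cong (choose μ P') r))

    module _ {μ x Q P} (μ≺x : Above μ x) (fP : Fillable μ (x ∷ Q) P) where

      chosen-valid : choose μ P ∈ P × Above μ (choose μ P)
      chosen-valid = let y , y∈ , μ≺y = Fillable-∷-∃ μ μ≺x fP in choose-valid μ y∈ μ≺y

      Fillable-chosen : Fillable μ Q (remove (choose μ P) P)
      Fillable-chosen = Fillable-∷-remove μ μ≺x fP (proj₁ chosen-valid) (proj₂ chosen-valid)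

    skeleton-fill : ∀ μ A P → Fillable μ (nonMinima μ A) P → skeleton μ (fill μ (skeleton μ A) P) ≡ skeleton μ A
    skeleton-fill μ [] P _ = refl
    skeleton-fill μ (x ∷ A) P fP with above? μ x
    ... | no  μ⊀x = trans (skeleton-newMin μ _ μ⊀x)
                          (cong (just x ∷_) (skeleton-fill (just x) A P (Fillable-newMin μ μ⊀x fP)))
    ... | yes μ≺x = trans (skeleton-above μ _ (proj₂ (chosen-valid μ≺x fP)))
                          (cong (nothing ∷_) (skeleton-fill μ A _ (Fillable-chosen μ≺x fP)))

    nonMinima-fill : ∀ μ A P → Fillable μ (nonMinima μ A) P → nonMinima μ (fill μ (skeleton μ A) P) ↭ P
    nonMinima-fill μ [] P fP = ↭-reflexive (sym (Fillable-[] {μ} fP))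
    nonMinima-fill μ (x ∷ A) P fP with above? μ x
    ... | no  μ⊀x = subst (_↭ P) (sym (nonMinima-newMin μ _ μ⊀x))
                      (nonMinima-fill (just x) A P (Fillable-newMin μ μ⊀x fP))
    ... | yes μ≺x = let p∈ , μ≺p = chosen-valid μ≺x fP in
      subst (_↭ P) (sym (nonMinima-above μ _ μ≺p))
        (↭-trans (prep _ (nonMinima-fill μ A _ (Fillable-chosen μ≺x fP))) (↭-sym (remove-↭ p∈)))

    fill-above-∈ : ∀ μ A P → Fillable μ (nonMinima μ A) P →
                   ∀ {y} → y ∈ fill μ (skeleton μ A) P → Above μ y → y ∈ P
    fill-above-∈ μ (x ∷ A) P fP y∈ μ≺y with above? μ x
    fill-above-∈ μ (x ∷ A) P fP (here refl) μ≺x | no μ⊀x = ⊥-elim (μ⊀x μ≺x)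
    fill-above-∈ μ (x ∷ A) P fP (there y∈)  μ≺y | no μ⊀x =
      fill-above-∈ (just x) A P (Fillable-newMin μ μ⊀x fP) y∈ (Above-newMin μ μ⊀x μ≺y)
    fill-above-∈ μ (x ∷ A) P fP (here refl) _   | yes μ≺x = proj₁ (chosen-valid μ≺x fP)
    fill-above-∈ μ (x ∷ A) P fP (there y∈)  μ≺y | yes μ≺x =
      ∈-remove⁻ P (fill-above-∈ μ A _ (Fillable-chosen μ≺x fP) y∈ μ≺y)

    module _ {Has : List ℕ → Set}
             (¬Has-short : ∀ μ → ¬ Has (fromMaybe μ))
             (¬Has-newMin : ∀ μ {x out} → ¬ Above μ x → ¬ Has (x ∷ out) → ¬ Has (fromMaybe μ ++ x ∷ out))
             (¬Has-chosen : ∀ μ {P out} → choose μ P ∈ P → Above μ (choose μ P) →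
                            (∀ {y} → y ∈ out → Above μ y → y ∈ P) →
                            ¬ Has (fromMaybe μ ++ out) → ¬ Has (fromMaybe μ ++ choose μ P ∷ out)) where

      fill-avoids : ∀ μ A P → Fillable μ (nonMinima μ A) P → ¬ Has (fromMaybe μ ++ fill μ (skeleton μ A) P)
      fill-avoids μ [] P _ = subst (λ xs → ¬ Has xs) (sym (++-identityʳ (fromMaybe μ))) (¬Has-short μ)
      fill-avoids μ (x ∷ A) P fP with above? μ x
      ... | no μ⊀x =
        ¬Has-newMin μ μ⊀x (fill-avoids (just x) A P (Fillable-newMin μ μ⊀x fP))
      ... | yes μ≺x = let p∈ , μ≺p = chosen-valid μ≺x fP ; fP′ = Fillable-chosen μ≺x fP in
        ¬Has-chosen μ p∈ μ≺p (λ y∈ μ≺y → ∈-remove⁻ P (fill-above-∈ μ A _ fP′ y∈ μ≺y)) (fill-avoids μ A _ fP′)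

    module _ {Has : List ℕ → Set}
             (Has-mono : ∀ {xs ys} → xs ⊆ ys → Has xs → Has ys)
             (choose-first : ∀ μ {x Q} → Above μ x → ¬ Has (fromMaybe μ ++ x ∷ Q) → choose μ (x ∷ Q) ≡ x) where

      fill-skeleton-nonMinima : ∀ μ A → ¬ Has (fromMaybe μ ++ A) → fill μ (skeleton μ A) (nonMinima μ A) ≡ A
      fill-skeleton-nonMinima μ [] _ = refl
      fill-skeleton-nonMinima μ (x ∷ A) ¬has with above? μ x
      ... | no _ =
        cong (x ∷_) (fill-skeleton-nonMinima (just x) A (¬has ∘ Has-mono (⊆.++⁺ˡ (fromMaybe μ) ⊆-refl)))
      ... | yes μ≺x
        rewrite choose-first μ μ≺x (¬has ∘ Has-mono (⊆.++⁺ ⊆-refl (refl ∷ nonMinima-⊆ μ A)))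
              | remove-head x (nonMinima μ A)
        = cong (x ∷_) (fill-skeleton-nonMinima μ A (¬has ∘ Has-mono (⊆.++⁺ ⊆-refl (x ∷ʳ ⊆-refl))))

    reshape : List ℕ → List ℕ
    reshape A = fill nothing (skeleton nothing A) (nonMinima nothing A)

    reshape-skeleton : ∀ A → skeleton nothing (reshape A) ≡ skeleton nothing A
    reshape-skeleton A = skeleton-fill nothing A _ (Fillable-refl nothing _)

    reshape-nonMinima : ∀ A → nonMinima nothing (reshape A) ↭ nonMinima nothing A
    reshape-nonMinima A = nonMinima-fill nothing A _ (Fillable-refl nothing _)

    reshape-↭ : ∀ A → reshape A ↭ A
    reshape-↭ A = ↭-from-skeleton nothing (reshape A) A (reshape-skeleton A) (reshape-nonMinima A)

    RisesTo-reshape : ∀ A {y} → RisesTo (reshape A) y → RisesTo A y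
    RisesTo-reshape A rises
      with ∈-nonMinima⁻ nothing A (∈-resp-↭ (reshape-nonMinima A) (∈-nonMinima⁺ nothing _ (inj₂ rises)))
    ... | inj₂ rises′ = rises′

  module _ (rule₁ rule₂ : FillingRule) {Has : List ℕ → Set}
           (Has-mono : ∀ {xs ys} → xs ⊆ ys → Has xs → Has ys)
           (choose₁-first : ∀ μ {x Q} → Above μ x → ¬ Has (fromMaybe μ ++ x ∷ Q) →
                            FillingRule.choose rule₁ μ (x ∷ Q) ≡ x) where

    private
      module F₁ = Filling rule₁
      module F₂ = Filling rule₂

    reshape-inverse : ∀ A → ¬ Has A → F₁.reshape (F₂.reshape A) ≡ A
    reshape-inverse A ¬has = begin
      F₁.fill nothing (skeleton nothing (F₂.reshape A)) (nonMinima nothing (F₂.reshape A))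
        ≡⟨ cong (λ sk → F₁.fill nothing sk (nonMinima nothing (F₂.reshape A))) (F₂.reshape-skeleton A) ⟩
      F₁.fill nothing (skeleton nothing A) (nonMinima nothing (F₂.reshape A))
        ≡⟨ F₁.fill-↭ nothing _ (F₂.reshape-nonMinima A) ⟩
      F₁.fill nothing (skeleton nothing A) (nonMinima nothing A)
        ≡⟨ F₁.fill-skeleton-nonMinima Has-mono choose₁-first nothing A ¬has ⟩
      A ∎
      where open ≡-Reasoning

  -- 0 on the empty list is a junk value.
  greatest least : List ℕ → ℕ
  greatest []       = 0
  greatest (x ∷ xs) = max x xs
  least []       = 0
  least (x ∷ xs) = min x xs

  greatest-∈ : ∀ {x xs} → x ∈ xs → greatest xs ∈ xs
  greatest-∈ {xs = y ∷ ys} _ = argmax-all id {P = _∈ y ∷ ys} (here refl) (All.tabulate there)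

  least-∈ : ∀ {x xs} → x ∈ xs → least xs ∈ xs
  least-∈ {xs = y ∷ ys} _ = argmin-all id {P = _∈ y ∷ ys} (here refl) (All.tabulate there)

  ≼-greatest : ∀ {y xs} → y ∈ xs → y ≼ greatest xs
  ≼-greatest {xs = y ∷ ys} (here refl) = ⊥≤max y ys
  ≼-greatest {xs = y ∷ ys} (there i)   = All.lookup (xs≤max y ys) i

  least-≼ : ∀ {y xs} → y ∈ xs → least xs ≼ y
  least-≼ {xs = y ∷ ys} (here refl) = min≤⊤ y ys
  least-≼ {xs = y ∷ ys} (there i)   = All.lookup (min≤xs y ys) i

  greatest-↭ : ∀ {P P'} → P ↭ P' → greatest P ≡ greatest P'
  greatest-↭ {[]} r rewrite ↭-empty-inv (↭-sym r) = refl
  greatest-↭ {x ∷ P} r = ≼-antisym (≼-greatest (∈-resp-↭ r (greatest-∈ (here refl))))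
                                   (≼-greatest (∈-resp-↭ (↭-sym r) (greatest-∈ (∈-resp-↭ r (here refl)))))

  least-↭ : ∀ {P P'} → P ↭ P' → least P ≡ least P'
  least-↭ {[]} r rewrite ↭-empty-inv (↭-sym r) = refl
  least-↭ {x ∷ P} r = ≼-antisym (least-≼ (∈-resp-↭ (↭-sym r) (least-∈ (∈-resp-↭ r (here refl)))))
                                (least-≼ (∈-resp-↭ r (least-∈ (here refl))))

  leastAbove : Maybe ℕ → List ℕ → ℕ
  leastAbove μ P = least (filter (above? μ) P)

  leastAbove-≼ : ∀ μ {y P} → y ∈ P → Above μ y → leastAbove μ P ≼ y
  leastAbove-≼ μ y∈ μ≺y = least-≼ (∈-filter⁺ (above? μ) y∈ μ≺y)

  greatestRule : FillingRule
  greatestRule = record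
    { choose       = λ _ → greatest
    ; choose-valid = λ μ y∈ μ≺y → greatest-∈ y∈ , Above-≼ μ μ≺y (≼-greatest y∈)
    ; choose-↭     = λ _ → greatest-↭
    }

  leastAboveRule : FillingRule
  leastAboveRule = record
    { choose       = leastAbove
    ; choose-valid = λ μ y∈ μ≺y → ∈-filter⁻ (above? μ) (least-∈ (∈-filter⁺ (above? μ) y∈ μ≺y))
    ; choose-↭     = λ μ r → least-↭ (filter-↭ (above? μ) r)
    }

  module To123 = Filling greatestRule
  module To132 = Filling leastAboveRule

  ¬Has123-newMin : ∀ μ {x out} → ¬ Above μ x → ¬ Has123 (x ∷ out) → ¬ Has123 (fromMaybe μ ++ x ∷ out)
  ¬Has123-newMin nothing _ ¬has = ¬has
  ¬Has123-newMin (just m) _ ¬has (a , b , c , _ ∷ʳ s , r) = ¬has (a , b , c , s , r)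
  ¬Has123-newMin (just m) {x} m⊀x ¬has (_ , b , c , refl ∷ (_ ∷ʳ s) , m≺b , b≺c) =
    ¬has (x , b , c , refl ∷ s , Above-newMin (just m) m⊀x m≺b , b≺c)
  ¬Has123-newMin (just m) m⊀x ¬has (_ , _ , c , refl ∷ (refl ∷ s) , m≺x , _) = m⊀x m≺x

  ¬Has132-newMin : ∀ μ {x out} → ¬ Above μ x → ¬ Has132 (x ∷ out) → ¬ Has132 (fromMaybe μ ++ x ∷ out)
  ¬Has132-newMin nothing _ ¬has = ¬has
  ¬Has132-newMin (just m) _ ¬has (a , b , c , _ ∷ʳ s , r) = ¬has (a , b , c , s , r)
  ¬Has132-newMin (just m) {x} m⊀x ¬has (_ , b , c , refl ∷ (_ ∷ʳ s) , m≺c , c≺b) =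
    ¬has (x , b , c , refl ∷ s , Above-newMin (just m) m⊀x m≺c , c≺b)
  ¬Has132-newMin (just m) m⊀x ¬has (_ , _ , c , refl ∷ (refl ∷ s) , m≺c , c≺x) = m⊀x (≺-trans m≺c c≺x)

  ¬Has123-greatest : ∀ μ {P out} → greatest P ∈ P → Above μ (greatest P) →
                     (∀ {y} → y ∈ out → Above μ y → y ∈ P) →
                     ¬ Has123 (fromMaybe μ ++ out) → ¬ Has123 (fromMaybe μ ++ greatest P ∷ out)
  ¬Has123-greatest (just m) _ _ _ ¬has (a , b , c , _ ∷ʳ (_ ∷ʳ s) , r) = ¬has (a , b , c , _ ∷ʳ s , r)
  ¬Has123-greatest (just m) _ m≺p pool _ (_ , b , c , _ ∷ʳ (refl ∷ s) , p≺b , _) =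
    ≼⇒≯ (≼-greatest (pool (head-∈ s) (≺-trans m≺p p≺b))) p≺b
  ¬Has123-greatest (just m) _ _ _ ¬has (_ , b , c , refl ∷ (_ ∷ʳ s) , r) = ¬has (m , b , c , refl ∷ s , r)
  ¬Has123-greatest (just m) _ m≺p pool _ (_ , _ , c , refl ∷ (refl ∷ s) , _ , p≺c) =
    ≼⇒≯ (≼-greatest (pool (head-∈ s) (≺-trans m≺p p≺c))) p≺c

  ¬Has132-leastAbove : ∀ μ {P out} → leastAbove μ P ∈ P → Above μ (leastAbove μ P) →
                       (∀ {y} → y ∈ out → Above μ y → y ∈ P) →
                       ¬ Has132 (fromMaybe μ ++ out) → ¬ Has132 (fromMaybe μ ++ leastAbove μ P ∷ out)
  ¬Has132-leastAbove (just m) _ _ _ ¬has (a , b , c , _ ∷ʳ (_ ∷ʳ s) , r) = ¬has (a , b , c , _ ∷ʳ s , r)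
  ¬Has132-leastAbove (just m) _ m≺p _ ¬has (_ , b , c , _ ∷ʳ (refl ∷ s) , p≺c , c≺b) =
    ¬has (m , b , c , refl ∷ s , ≺-trans m≺p p≺c , c≺b)
  ¬Has132-leastAbove (just m) _ _ _ ¬has (_ , b , c , refl ∷ (_ ∷ʳ s) , r) = ¬has (m , b , c , refl ∷ s , r)
  ¬Has132-leastAbove (just m) _ _ pool _ (_ , _ , c , refl ∷ (refl ∷ s) , m≺c , c≺p) =
    ≼⇒≯ (leastAbove-≼ (just m) (pool (head-∈ s) m≺c) m≺c) c≺p

  greatest-first : ∀ μ {x Q} → Above μ x → ¬ Has123 (fromMaybe μ ++ x ∷ Q) → greatest (x ∷ Q) ≡ x
  greatest-first (just m) {x} {Q} m≺x ¬has =
    ≼-antisym (max≤v⁺ ≼-refl (All.tabulate λ c∈ → ≯⇒≼ λ x≺c →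
                 ¬has (m , x , _ , refl ∷ refl ∷ from∈ c∈ , m≺x , x≺c)))
              (⊥≤max x Q)

  leastAbove-first : ∀ μ {x Q} → Above μ x → ¬ Has132 (fromMaybe μ ++ x ∷ Q) → leastAbove μ (x ∷ Q) ≡ x
  leastAbove-first (just m) {x} {Q} m≺x ¬has rewrite filter-accept (above? (just m)) {xs = Q} m≺x =
    ≼-antisym (min≤⊤ x (filter (above? (just m)) Q)) (v≤min⁺ ≼-refl (All.tabulate below))
    where
    below : ∀ {c} → c ∈ filter (above? (just m)) Q → x ≼ c
    below c∈ with ∈-filter⁻ (above? (just m)) c∈
    ... | c∈Q , m≺c = ≯⇒≼ λ c≺x → ¬has (m , x , _ , refl ∷ refl ∷ from∈ c∈Q , m≺c , c≺x)

  To123-avoids : ∀ A → ¬ Has123 (To123.reshape A)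
  To123-avoids A = To123.fill-avoids {Has123} ¬Occurs-fromMaybe ¬Has123-newMin ¬Has123-greatest
                                     nothing A _ (Fillable-refl nothing _)

  To132-avoids : ∀ A → ¬ Has132 (To132.reshape A)
  To132-avoids A = To132.fill-avoids {Has132} ¬Occurs-fromMaybe ¬Has132-newMin ¬Has132-leastAbove
                                     nothing A _ (Fillable-refl nothing _)

  To123∘To132 : ∀ A → ¬ Has123 A → To123.reshape (To132.reshape A) ≡ A
  To123∘To132 = reshape-inverse greatestRule leastAboveRule {Has123} Occurs-mono greatest-first

  To132∘To123 : ∀ A → ¬ Has132 A → To132.reshape (To123.reshape A) ≡ A
  To132∘To123 = reshape-inverse leastAboveRule greatestRule {Has132} Occurs-mono leastAbove-first

module Up   = SimionSchmidt <-isStrictTotalOrder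
module Down = SimionSchmidt (Flip.isStrictTotalOrder <-isStrictTotalOrder)

Has213 : List ℕ → Set
Has213 = Occurs (λ a b c → b < a × a < c)

AscentFrom : List ℕ → ℕ → Set
AscentFrom B y = ∃[ z ] (y ∷ z ∷ []) ⊆ B × y < z

LowBeforeAscent AscentBeforeHigh : List ℕ → List ℕ → Set
LowBeforeAscent  A B = ∃[ x ] ∃[ y ] x ∈ A × AscentFrom B y × x < y
AscentBeforeHigh A B = ∃[ y ] ∃[ z ] Up.RisesTo A y × z ∈ B × y < z

NoCrossing : List ℕ → List ℕ → Set
NoCrossing A B = ¬ LowBeforeAscent A B × ¬ AscentBeforeHigh A B

Avoids1234◇ Avoids1324◇ : List ℕ → List ℕ → Set
Avoids1234◇ A B = ¬ Up.Has123 A × ¬ Up.Has123 B × NoCrossing A B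
Avoids1324◇ A B = ¬ Up.Has132 A × ¬ Has213 B × NoCrossing A B

NoCrossing-transfer : ∀ {A B A' B'} → A' ↭ A → B' ↭ B →
                      (∀ {y} → Up.RisesTo A' y → Up.RisesTo A y) → (∀ {y} → AscentFrom B' y → AscentFrom B y) →
                      NoCrossing A B → NoCrossing A' B'
NoCrossing-transfer A'↭A B'↭B rises ascent (¬low , ¬asc) =
  (λ (x , y , x∈ , asc , x<y) → ¬low (x , y , ∈-resp-↭ A'↭A x∈ , ascent asc , x<y)) ,
  (λ (y , z , r , z∈ , y<z) → ¬asc (y , z , rises r , ∈-resp-↭ B'↭B z∈ , y<z))

-- The right-hand side of the hole is handled by reading it backwards, in the reversed order.
mirror : (List ℕ → List ℕ) → List ℕ → List ℕ
mirror f B = reverse (f (reverse B))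

module _ {f : List ℕ → List ℕ} where

  mirror-↭ : (∀ X → f X ↭ X) → ∀ B → mirror f B ↭ B
  mirror-↭ f↭ B = ↭-trans (↭-reverse _) (↭-trans (f↭ (reverse B)) (↭-reverse B))

  AscentFrom-mirror : (∀ X {y} → Down.RisesTo (f X) y → Down.RisesTo X y) →
                      ∀ B {y} → AscentFrom (mirror f B) y → AscentFrom B y
  AscentFrom-mirror rises B (z , s , y<z) with rises (reverse B) (z , ⊆-reverse s , y<z)
  ... | z′ , s′ , y<z′ = z′ , ⊆-reverse s′ , y<z′

  mirror-mirror : ∀ {g} B → g (f (reverse B)) ≡ reverse B → mirror g (mirror f B) ≡ B
  mirror-mirror {g} B gf≡ = begin
    reverse (g (reverse (reverse (f (reverse B))))) ≡⟨ cong (reverse ∘ g) (reverse-involutive _) ⟩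
    reverse (g (f (reverse B)))                      ≡⟨ cong reverse gf≡ ⟩
    reverse (reverse B)                              ≡⟨ reverse-involutive B ⟩
    B                                                ∎
    where open ≡-Reasoning

to1324◇-avoids : ∀ A B → Avoids1234◇ A B → Avoids1324◇ (Up.To132.reshape A) (mirror Down.To132.reshape B)
to1324◇-avoids A B (_ , _ , noCrossing) =
  Up.To132-avoids A ,
  Down.To132-avoids (reverse B) ∘ Occurs-reverse ×-swap ,
  NoCrossing-transfer (Up.To132.reshape-↭ A) (mirror-↭ Down.To132.reshape-↭ B)
                      (Up.To132.RisesTo-reshape A) (AscentFrom-mirror Down.To132.RisesTo-reshape B) noCrossing

to1234◇-avoids : ∀ A B → Avoids1324◇ A B → Avoids1234◇ (Up.To123.reshape A) (mirror Down.To123.reshape B)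
to1234◇-avoids A B (_ , _ , noCrossing) =
  Up.To123-avoids A ,
  Down.To123-avoids (reverse B) ∘ Occurs-reverse ×-swap ,
  NoCrossing-transfer (Up.To123.reshape-↭ A) (mirror-↭ Down.To123.reshape-↭ B)
                      (Up.To123.RisesTo-reshape A) (AscentFrom-mirror Down.To123.RisesTo-reshape B) noCrossing

to1234◇∘to1324◇ : ∀ A B → Avoids1234◇ A B →
                  Up.To123.reshape (Up.To132.reshape A) ≡ A ×
                  mirror Down.To123.reshape (mirror Down.To132.reshape B) ≡ B
to1234◇∘to1324◇ A B (¬A , ¬B , _) =
  Up.To123∘To132 A ¬A ,
  mirror-mirror {Down.To132.reshape} {Down.To123.reshape} B
    (Down.To123∘To132 (reverse B) (¬B ∘ Occurs-reverse ×-swap))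

to1324◇∘to1234◇ : ∀ A B → Avoids1324◇ A B →
                  Up.To132.reshape (Up.To123.reshape A) ≡ A ×
                  mirror Down.To132.reshape (mirror Down.To123.reshape B) ≡ B
to1324◇∘to1234◇ A B (¬A , ¬B , _) =
  Up.To132∘To123 A ¬A ,
  mirror-mirror {Down.To123.reshape} {Down.To132.reshape} B
    (Down.To132∘To123 (reverse B) (¬B ∘ Occurs-reverse ×-swap))

∈-range1⁻ : ∀ {k n} → k ∈ range1 n → 1 ≤ k × k ≤ n
∈-range1⁻ k∈ with ∈-applyUpTo⁻ suc k∈
... | _ , i<n , refl = s≤s z≤n , i<n

∈-range1⁺ : ∀ {k n} → 1 ≤ k → k ≤ n → k ∈ range1 n
∈-range1⁺ {suc k} _ k<n = ∈-applyUpTo⁺ suc k<n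

range1-unique : ∀ n → Unique (range1 n)
range1-unique n = Unique.applyUpTo⁺₁ suc n (λ i<j _ → <⇒≢ i<j ∘ suc-injective)

module _ {X : Set} (alph : List X) where

  ∈-words⁻ : ∀ n {xs} → xs ∈ words alph n → length xs ≡ n × All (_∈ alph) xs
  ∈-words⁻ zero (here refl) = refl , []
  ∈-words⁻ (suc n) w∈ with find (∈-concatMap⁻ (λ a → map (a ∷_) (words alph n)) {xs = alph} w∈)
  ... | a , a∈ , aw∈ with ∈-map⁻ (a ∷_) aw∈
  ... | w , w∈ , refl = let len , all∈ = ∈-words⁻ n w∈ in cong suc len , a∈ ∷ all∈

  ∈-words⁺ : ∀ n {xs} → length xs ≡ n → All (_∈ alph) xs → xs ∈ words alph n
  ∈-words⁺ zero {[]} refl [] = here refl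
  ∈-words⁺ (suc n) {x ∷ xs} len (x∈ ∷ all∈) =
    ∈-concatMap⁺ (λ a → map (a ∷_) (words alph n))
      (Any.map (λ { refl → ∈-map⁺ (x ∷_) (∈-words⁺ n (suc-injective len) all∈) }) x∈)

  words-unique : ∀ n → Unique alph → Unique (words alph n)
  words-unique zero _ = [] ∷ []
  words-unique (suc n) u = go alph u
    where
    W = words alph n
    go : ∀ as → Unique as → Unique (concatMap (λ a → map (a ∷_) W) as)
    go [] _ = []
    go (a ∷ as) (a∉as ∷ uas) = Unique.++⁺ (Unique.map⁺ ∷-injectiveʳ (words-unique n u)) (go as uas) disjoint
      where
      disjoint : ∀ {v} → ¬ (v ∈ map (a ∷_) W × v ∈ concatMap (λ a → map (a ∷_) W) as)
      disjoint (v∈₁ , v∈₂) with ∈-map⁻ (a ∷_) v∈₁ | find (∈-concatMap⁻ (λ a → map (a ∷_) W) {xs = as} v∈₂)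
      ... | _ , _ , refl | b , b∈ , v∈b with ∈-map⁻ (b ∷_) v∈b
      ... | _ , _ , refl = All.lookup a∉as b∈ refl

partialPerms1-unique : ∀ n → Unique (partialPerms1 n)
partialPerms1-unique n = Unique.filter⁺ _ (words-unique _ n alphabet-unique)
  where
  alphabet-unique : Unique (nothing ∷ map just (range1 (n ∸ 1)))
  alphabet-unique = All.tabulate (λ j∈ → λ { refl → nothing∉ j∈ }) ∷ Unique.map⁺ just-injective (range1-unique _)
    where
    nothing∉ : ∀ {ks} → nothing ∉ map just ks
    nothing∉ j∈ with ∈-map⁻ just j∈
    ... | _ , _ , ()

==L⇒≡ : ∀ xs ys → T (xs ==L ys) → xs ≡ ys
==L⇒≡ [] [] _ = refl
==L⇒≡ (x ∷ xs) (y ∷ ys) t =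
  let x≡y , xs≡ys = Equivalence.to (T-∧ {x ≡ᵇ y}) t in cong₂ _∷_ (≡ᵇ⇒≡ x y x≡y) (==L⇒≡ xs ys xs≡ys)

==L-refl : ∀ xs → T (xs ==L xs)
==L-refl [] = tt
==L-refl (x ∷ xs) = Equivalence.from T-∧ (≡⇒≡ᵇ x x refl , ==L-refl xs)

T-≡true : ∀ {b} → T b → b ≡ true
T-≡true = Equivalence.to T-≡

<ᵇ-true : ∀ {a b} → a < b → (a <ᵇ b) ≡ true
<ᵇ-true = T-≡true ∘ <⇒<ᵇ

≡ᵇ-refl : ∀ a → (a ≡ᵇ a) ≡ true
≡ᵇ-refl a = T-≡true (≡⇒≡ᵇ a a refl)

<ᵇ-false : ∀ {a b} → ¬ a < b → (a <ᵇ b) ≡ false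
<ᵇ-false {a} {b} a≮b with a <ᵇ b in eq
... | true  = ⊥-elim (a≮b (<ᵇ⇒< a b (subst T (sym eq) tt)))
... | false = refl

<ᵇ-irrefl : ∀ a → (a <ᵇ a) ≡ false
<ᵇ-irrefl a = <ᵇ-false (<-irrefl {a} refl)

≡ᵇ-false : ∀ {a b} → a ≢ b → (a ≡ᵇ b) ≡ false
≡ᵇ-false {a} {b} a≢b with a ≡ᵇ b in eq
... | true  = ⊥-elim (a≢b (≡ᵇ⇒≡ a b (subst T (sym eq) tt)))
... | false = refl

module _ {X : Set} (p q : X → Bool) where

  length-filterᵇ-mono : ∀ xs → (∀ y → T (p y) → T (q y)) → length (filterᵇ p xs) ≤ length (filterᵇ q xs)
  length-filterᵇ-mono [] _ = z≤n
  length-filterᵇ-mono (y ∷ ys) p⇒q with p y in py | q y in qy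
  ... | true  | true  = s≤s (length-filterᵇ-mono ys p⇒q)
  ... | false | true  = ≤-trans (length-filterᵇ-mono ys p⇒q) (n≤1+n _)
  ... | false | false = length-filterᵇ-mono ys p⇒q
  ... | true  | false = ⊥-elim (subst T qy (p⇒q y (subst T (sym py) tt)))

  length-filterᵇ-< : ∀ {x} xs → (∀ y → T (p y) → T (q y)) → x ∈ xs → p x ≡ false → q x ≡ true →
                     length (filterᵇ p xs) < length (filterᵇ q xs)
  length-filterᵇ-< (y ∷ ys) p⇒q (here refl) px qx rewrite px | qx = s≤s (length-filterᵇ-mono ys p⇒q)
  length-filterᵇ-< (y ∷ ys) p⇒q (there x∈) px qx with p y in py | q y in qy
  ... | true  | true  = s≤s (length-filterᵇ-< ys p⇒q x∈ px qx)
  ... | false | true  = ≤-trans (length-filterᵇ-< ys p⇒q x∈ px qx) (n≤1+n _)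
  ... | false | false = length-filterᵇ-< ys p⇒q x∈ px qx
  ... | true  | false = ⊥-elim (subst T qy (p⇒q y (subst T (sym py) tt)))

  length-filterᵇ-cong : ∀ xs → (∀ y → p y ≡ q y) → length (filterᵇ p xs) ≡ length (filterᵇ q xs)
  length-filterᵇ-cong [] _ = refl
  length-filterᵇ-cong (y ∷ ys) p≡q rewrite p≡q y with q y
  ... | true  = cong suc (length-filterᵇ-cong ys p≡q)
  ... | false = length-filterᵇ-cong ys p≡q

module _ {X : Set} (p : X → Bool) where

  length-filterᵇ-none : ∀ xs → (∀ {y} → y ∈ xs → p y ≡ false) → length (filterᵇ p xs) ≡ 0
  length-filterᵇ-none [] _ = refl
  length-filterᵇ-none (y ∷ ys) none rewrite none (here refl) = length-filterᵇ-none ys (none ∘ there)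

  length-filterᵇ-++ : ∀ xs ys → length (filterᵇ p (xs ++ ys)) ≡ length (filterᵇ p xs) + length (filterᵇ p ys)
  length-filterᵇ-++ xs ys = trans (cong length (filter-++ (T? ∘ p) xs ys)) (length-++ (filterᵇ p xs))

  length-filterᵇ-map : ∀ {W : Set} (f : W → X) xs → length (filterᵇ p (map f xs)) ≡ length (filterᵇ (p ∘ f) xs)
  length-filterᵇ-map f [] = refl
  length-filterᵇ-map f (x ∷ xs) with p (f x)
  ... | true  = cong suc (length-filterᵇ-map f xs)
  ... | false = length-filterᵇ-map f xs

rank : List ℕ → ℕ → ℕ
rank xs x = length (filterᵇ (_<ᵇ x) xs)

rank-mono : ∀ xs {a b} → a ≤ b → rank xs a ≤ rank xs b
rank-mono xs {a} a≤b = length-filterᵇ-mono _ _ xs (λ y y<a → <⇒<ᵇ (<-≤-trans (<ᵇ⇒< y a y<a) a≤b))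

rank-strict : ∀ xs {a b} → a ∈ xs → a < b → rank xs a < rank xs b
rank-strict xs {a} a∈ a<b = length-filterᵇ-< (_<ᵇ a) _ xs (λ y y<a → <⇒<ᵇ (<-trans (<ᵇ⇒< y a y<a) a<b))
                                            a∈ (<ᵇ-false (<-irrefl {a} refl)) (<ᵇ-true a<b)

rank-cancel-< : ∀ xs {a b} → rank xs a < rank xs b → a < b
rank-cancel-< xs {a} {b} r< with a <? b
... | yes a<b = a<b
... | no  a≮b = ⊥-elim (<⇒≱ r< (rank-mono xs (≮⇒≥ a≮b)))

count : ℕ → List ℕ → ℕ
count = occ _≡ᵇ_

count-↭ : ∀ k {xs ys} → xs ↭ ys → count k xs ≡ count k ys
count-↭ k r = ↭-length (filter-↭ _ r)

record IsPermutation (τ : List ℕ) : Set where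
  field
    bounded : ∀ {x} → x ∈ τ → 1 ≤ x × x ≤ length τ
    once    : ∀ {k} → 1 ≤ k → k ≤ length τ → count k τ ≡ 1

rank-suc : ∀ τ i → rank τ (suc i) ≡ rank τ i + count i τ
rank-suc [] i = refl
rank-suc (y ∷ τ) i with <-cmp y i
... | tri< y<i _ _ rewrite <ᵇ-true (≤-trans y<i (n≤1+n _)) | <ᵇ-true y<i | ≡ᵇ-false (>⇒≢ y<i) =
  cong suc (rank-suc τ i)
... | tri≈ _ refl _ rewrite <ᵇ-true (n<1+n y) | <ᵇ-false (<-irrefl {y} refl) | ≡ᵇ-refl y =
  trans (cong suc (rank-suc τ y)) (sym (+-suc _ _))
... | tri> _ _ i<y rewrite <ᵇ-false (<⇒≱ (s≤s i<y)) | <ᵇ-false (<⇒≯ i<y) | ≡ᵇ-false (<⇒≢ i<y) = rank-suc τ i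

rank-perm : ∀ τ → IsPermutation τ → ∀ i → i ≤ length τ → rank τ (suc i) ≡ i
rank-perm τ perm zero _ =
  length-filterᵇ-none _ τ λ y∈ → <ᵇ-false (λ y<1 → <⇒≱ y<1 (proj₁ (IsPermutation.bounded perm y∈)))
rank-perm τ perm (suc i) i<τ = begin
  rank τ (suc (suc i))            ≡⟨ rank-suc τ (suc i) ⟩
  rank τ (suc i) + count (suc i) τ ≡⟨ cong₂ _+_ (rank-perm τ perm i (≤-trans (n≤1+n i) i<τ))
                                                (IsPermutation.once perm (s≤s z≤n) i<τ) ⟩
  i + 1                           ≡⟨ +-comm i 1 ⟩
  suc i                           ∎
  where open ≡-Reasoning

st-perm : ∀ τ → IsPermutation τ → st τ ≡ τ
st-perm τ perm = map-id-local (All.tabulate fixed)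
  where
  fixed : ∀ {x} → x ∈ τ → suc (rank τ x) ≡ x
  fixed {x} x∈ with IsPermutation.bounded perm x∈
  fixed {suc x} x∈ | _ , x<τ = cong suc (rank-perm τ perm x (≤-trans (n≤1+n x) x<τ))

bump : ℕ → ℕ → ℕ
bump v x with x <? v
... | yes _ = x
... | no  _ = suc x

bump-< : ∀ {v x} → x < v → bump v x ≡ x
bump-< {v} {x} x<v with x <? v
... | yes _   = refl
... | no  x≮v = ⊥-elim (x≮v x<v)

bump-≥ : ∀ {v x} → ¬ x < v → bump v x ≡ suc x
bump-≥ {v} {x} x≮v with x <? v
... | yes x<v = ⊥-elim (x≮v x<v)
... | no  _   = refl

bump-<ᵇ : ∀ v x y → (bump v y <ᵇ bump v x) ≡ (y <ᵇ x)
bump-<ᵇ v x y with y <? v | x <? v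
... | yes y<v | yes x<v = refl
... | no  y≮v | no  x≮v = refl
... | yes y<v | no  x≮v
  rewrite <ᵇ-true (≤-trans y<v (≤-trans (≮⇒≥ x≮v) (n≤1+n x))) | <ᵇ-true (<-≤-trans y<v (≮⇒≥ x≮v)) = refl
... | no  y≮v | yes x<v
  rewrite <ᵇ-false (λ y<x → <-irrefl refl (<-trans x<v (≤-<-trans (≮⇒≥ y≮v) (<-trans (n<1+n y) y<x))))
        | <ᵇ-false (λ y<x → <-irrefl refl (<-trans x<v (≤-<-trans (≮⇒≥ y≮v) y<x))) = refl

bump-mono-< : ∀ v {x y} → x < y → bump v x < bump v y
bump-mono-< v {x} {y} x<y = <ᵇ⇒< _ _ (subst T (sym (bump-<ᵇ v y x)) (<⇒<ᵇ x<y))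

<-bump : ∀ {v x} → x < v → bump v x < v
<-bump x<v rewrite bump-< x<v = x<v

>-bump : ∀ {v x} → v ≤ x → v < bump v x
>-bump {v} {x} v≤x rewrite bump-≥ {v} {x} (≤⇒≯ v≤x) = s≤s v≤x

st-map-bump : ∀ v τ → st (map (bump v) τ) ≡ st τ
st-map-bump v τ = trans (sym (map-∘ τ)) (map-cong same-rank τ)
  where
  same-rank : ∀ x → suc (rank (map (bump v) τ) (bump v x)) ≡ suc (rank τ x)
  same-rank x = cong suc (trans (length-filterᵇ-map (_<ᵇ bump v x) (bump v) τ)
                                (length-filterᵇ-cong _ _ τ (bump-<ᵇ v x)))

count-bump-< : ∀ {k v} τ → k < v → count k (map (bump v) τ) ≡ count k τ
count-bump-< {k} {v} τ k<v = trans (length-filterᵇ-map _ (bump v) τ) (length-filterᵇ-cong _ _ τ same)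
  where
  same : ∀ y → (k ≡ᵇ bump v y) ≡ (k ≡ᵇ y)
  same y with y <? v
  ... | yes y<v = refl
  ... | no  y≮v rewrite ≡ᵇ-false (<⇒≢ (<-≤-trans k<v (≤-trans (≮⇒≥ y≮v) (n≤1+n y))))
                      | ≡ᵇ-false (<⇒≢ (<-≤-trans k<v (≮⇒≥ y≮v))) = refl

count-bump-≡ : ∀ v τ → count v (map (bump v) τ) ≡ 0
count-bump-≡ v τ = trans (length-filterᵇ-map _ (bump v) τ) (length-filterᵇ-none _ τ (λ {y} _ → differ y))
  where
  differ : ∀ y → (v ≡ᵇ bump v y) ≡ false
  differ y with y <? v
  ... | yes y<v = ≡ᵇ-false (>⇒≢ y<v)
  ... | no  y≮v = ≡ᵇ-false (λ v≡ → y≮v (subst (y <_) (sym v≡) (n<1+n y)))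

count-bump-> : ∀ {k v} τ → v < suc k → count (suc k) (map (bump v) τ) ≡ count k τ
count-bump-> {k} {v} τ v≤k = trans (length-filterᵇ-map _ (bump v) τ) (length-filterᵇ-cong _ _ τ same)
  where
  same : ∀ y → (suc k ≡ᵇ bump v y) ≡ (k ≡ᵇ y)
  same y with y <? v
  ... | yes y<v rewrite ≡ᵇ-false (>⇒≢ (<-trans y<v v≤k)) | ≡ᵇ-false (>⇒≢ (<-≤-trans y<v (≤-pred v≤k))) = refl
  ... | no  y≮v = refl

st4-ranks : ∀ {w x y z a b c d} → st (w ∷ x ∷ y ∷ z ∷ []) ≡ suc a ∷ suc b ∷ suc c ∷ suc d ∷ [] →
            let s = w ∷ x ∷ y ∷ z ∷ [] in rank s w ≡ a × rank s x ≡ b × rank s y ≡ c × rank s z ≡ d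
st4-ranks refl = refl , refl , refl , refl

rank-ordered : ∀ s {u u' i j} → rank s u ≡ i → rank s u' ≡ j → i < j → u < u'
rank-ordered s refl refl = rank-cancel-< s

st4-1234⁻ : ∀ {w x y z} → st (w ∷ x ∷ y ∷ z ∷ []) ≡ 1 ∷ 2 ∷ 3 ∷ 4 ∷ [] → w < x × x < y × y < z
st4-1234⁻ {w} {x} {y} {z} e with st4-ranks {w} {x} {y} {z} e
... | rw , rx , ry , rz = rank-ordered s rw rx ≤-refl , rank-ordered s rx ry ≤-refl , rank-ordered s ry rz ≤-refl
  where s = w ∷ x ∷ y ∷ z ∷ []

st4-1324⁻ : ∀ {w x y z} → st (w ∷ x ∷ y ∷ z ∷ []) ≡ 1 ∷ 3 ∷ 2 ∷ 4 ∷ [] → w < y × y < x × x < z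
st4-1324⁻ {w} {x} {y} {z} e with st4-ranks {w} {x} {y} {z} e
... | rw , rx , ry , rz = rank-ordered s rw ry ≤-refl , rank-ordered s ry rx ≤-refl , rank-ordered s rx rz ≤-refl
  where s = w ∷ x ∷ y ∷ z ∷ []

-- The rewrites follow the order in which st evaluates the comparisons.
st4-1234⁺ : ∀ {w x y z} → w < x → x < y → y < z → st (w ∷ x ∷ y ∷ z ∷ []) ≡ 1 ∷ 2 ∷ 3 ∷ 4 ∷ []
st4-1234⁺ {w} {x} {y} {z} w<x x<y y<z
  rewrite <ᵇ-irrefl w | <ᵇ-false (<⇒≯ w<x) | <ᵇ-false (<⇒≯ (<-trans w<x x<y))
        | <ᵇ-false (<⇒≯ (<-trans w<x (<-trans x<y y<z)))
        | <ᵇ-true w<x | <ᵇ-irrefl x | <ᵇ-false (<⇒≯ x<y) | <ᵇ-false (<⇒≯ (<-trans x<y y<z))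
        | <ᵇ-true (<-trans w<x x<y) | <ᵇ-true x<y | <ᵇ-irrefl y | <ᵇ-false (<⇒≯ y<z)
        | <ᵇ-true (<-trans w<x (<-trans x<y y<z)) | <ᵇ-true (<-trans x<y y<z) | <ᵇ-true y<z | <ᵇ-irrefl z = refl

st4-1324⁺ : ∀ {w x y z} → w < y → y < x → x < z → st (w ∷ x ∷ y ∷ z ∷ []) ≡ 1 ∷ 3 ∷ 2 ∷ 4 ∷ []
st4-1324⁺ {w} {x} {y} {z} w<y y<x x<z
  rewrite <ᵇ-irrefl w | <ᵇ-false (<⇒≯ (<-trans w<y y<x)) | <ᵇ-false (<⇒≯ w<y)
        | <ᵇ-false (<⇒≯ (<-trans w<y (<-trans y<x x<z)))
        | <ᵇ-true (<-trans w<y y<x) | <ᵇ-irrefl x | <ᵇ-true y<x | <ᵇ-false (<⇒≯ x<z)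
        | <ᵇ-true w<y | <ᵇ-false (<⇒≯ y<x) | <ᵇ-irrefl y | <ᵇ-false (<⇒≯ (<-trans y<x x<z))
        | <ᵇ-true (<-trans w<y (<-trans y<x x<z)) | <ᵇ-true x<z | <ᵇ-true (<-trans y<x x<z) | <ᵇ-irrefl z = refl

-- Partial permutations with one hole and their extensions
infix 5 _◇_
_◇_ : List ℕ → List ℕ → PWord
A ◇ B = map just A ++ nothing ∷ map just B

split◇ : PWord → List ℕ × List ℕ
split◇ [] = [] , []
split◇ (nothing ∷ π) = [] , filled π
split◇ (just x ∷ π) = let A , B = split◇ π in x ∷ A , B

filled-map-just : ∀ B → filled (map just B) ≡ B
filled-map-just [] = refl
filled-map-just (x ∷ B) = cong (x ∷_) (filled-map-just B)

split◇-◇ : ∀ A B → split◇ (A ◇ B) ≡ (A , B)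
split◇-◇ [] B = cong ([] ,_) (filled-map-just B)
split◇-◇ (x ∷ A) B rewrite split◇-◇ A B = refl

filled-◇ : ∀ A B → filled (A ◇ B) ≡ A ++ B
filled-◇ [] B = filled-map-just B
filled-◇ (x ∷ A) B = cong (x ∷_) (filled-◇ A B)

length-◇ : ∀ A B → length (A ◇ B) ≡ suc (length (A ++ B))
length-◇ [] B = cong suc (length-map just B)
length-◇ (x ∷ A) B = cong suc (length-◇ A B)

count-just : ∀ k B → occ eqM (just k) (map just B) ≡ count k B
count-just k [] = refl
count-just k (x ∷ B) with k ≡ᵇ x
... | true  = cong suc (count-just k B)
... | false = count-just k B

count-just-◇ : ∀ k A B → occ eqM (just k) (A ◇ B) ≡ count k (A ++ B)
count-just-◇ k A B = begin
  occ eqM (just k) (A ◇ B)                                      ≡⟨ length-filterᵇ-++ (eqM (just k)) (map just A) _ ⟩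
  occ eqM (just k) (map just A) + occ eqM (just k) (map just B) ≡⟨ cong₂ _+_ (count-just k A) (count-just k B) ⟩
  count k A + count k B                                         ≡⟨ length-filterᵇ-++ (k ≡ᵇ_) A B ⟨
  count k (A ++ B)                                              ∎
  where open ≡-Reasoning

◇-split◇ : ∀ π → occ eqM nothing π ≡ 1 → proj₁ (split◇ π) ◇ proj₂ (split◇ π) ≡ π
◇-split◇ (nothing ∷ π) one = cong (nothing ∷_) (sym (no-hole π (suc-injective one)))
  where
  no-hole : ∀ π → occ eqM nothing π ≡ 0 → π ≡ map just (filled π)
  no-hole [] _ = refl
  no-hole (just x ∷ π) none = cong (just x ∷_) (no-hole π none)
◇-split◇ (just x ∷ π) one = cong (just x ∷_) (◇-split◇ π one)

holeAt-◇ : ∀ A B → T (holeAt (suc (length A)) (A ◇ B))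
holeAt-◇ [] B = tt
holeAt-◇ (x ∷ A) B = holeAt-◇ A B

holeAt-◇-length : ∀ {j} (A A' B' : List ℕ) → j ≡ suc (length A) → length A' ≡ length A → T (holeAt j (A' ◇ B'))
holeAt-◇-length A A' B' refl len rewrite sym len = holeAt-◇ A' B'

holeAt-◇⁻ : ∀ j A B → T (holeAt j (A ◇ B)) → j ≡ suc (length A)
holeAt-◇⁻ (suc zero) [] B _ = refl
holeAt-◇⁻ (suc (suc j)) [] B hole = ⊥-elim (no-hole (suc j) B hole)
  where
  no-hole : ∀ j B → ¬ T (holeAt j (map just B))
  no-hole (suc (suc j)) (x ∷ B) hole = no-hole (suc j) B hole
holeAt-◇⁻ (suc (suc j)) (x ∷ A) B hole = cong suc (holeAt-◇⁻ (suc j) A B hole)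

restrictTo-◇ : ∀ A B {A' v B'} → length A' ≡ length A → length B' ≡ length B →
               restrictTo (A ◇ B) (A' ++ v ∷ B') ≡ A' ++ B'
restrictTo-◇ [] B {[]} _ lenB = restrict-right B lenB
  where
  restrict-right : ∀ B {B'} → length B' ≡ length B → restrictTo (map just B) B' ≡ B'
  restrict-right [] {[]} _ = refl
  restrict-right (x ∷ B) {y ∷ B'} len = cong (y ∷_) (restrict-right B (suc-injective len))
restrictTo-◇ (x ∷ A) B {y ∷ A'} lenA lenB = cong (y ∷_) (restrictTo-◇ A B (suc-injective lenA) lenB)

split-at-hole : ∀ (A B : List ℕ) σ → length σ ≡ suc (length A + length B) →
                Σ[ A' ∈ List ℕ ] Σ[ v ∈ ℕ ] Σ[ B' ∈ List ℕ ]
                  σ ≡ A' ++ v ∷ B' × length A' ≡ length A × length B' ≡ length B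
split-at-hole [] B (v ∷ σ) len = [] , v , σ , refl , refl , suc-injective len
split-at-hole (x ∷ A) B (y ∷ σ) len with split-at-hole A B σ (suc-injective len)
... | A' , v , B' , refl , lenA , lenB = y ∷ A' , v , B' , refl , cong suc lenA , lenB

-- The extension of A ◇ B with the value v in the hole.
fillHole : ℕ → List ℕ → List ℕ → List ℕ
fillHole v A B = map (bump v) A ++ v ∷ map (bump v) B

fillHole-↭ : ∀ v A B → fillHole v A B ↭ v ∷ map (bump v) (A ++ B)
fillHole-↭ v A B = subst (λ τ → fillHole v A B ↭ v ∷ τ) (sym (map-++ (bump v) A B)) (shift v (map (bump v) A) _)

length-fillHole : ∀ v A B → length (fillHole v A B) ≡ suc (length (A ++ B))
length-fillHole v A B = trans (↭-length (fillHole-↭ v A B)) (cong suc (length-map (bump v) (A ++ B)))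

⊆-fillHole : ∀ v {A B s₁ s₂} → s₁ ⊆ A → s₂ ⊆ B → map (bump v) s₁ ++ v ∷ map (bump v) s₂ ⊆ fillHole v A B
⊆-fillHole v s₁⊆ s₂⊆ = ⊆.++⁺ (⊆.map⁺ (bump v) s₁⊆) (refl ∷ ⊆.map⁺ (bump v) s₂⊆)

module _ (A B : List ℕ) (perm : IsPermutation (A ++ B)) {v} (1≤v : 1 ≤ v) (v≤ : v ≤ suc (length (A ++ B))) where

  open IsPermutation perm

  private
    n = suc (length (A ++ B))

  count-fillHole : ∀ {k} → 1 ≤ k → k ≤ n → count k (fillHole v A B) ≡ 1
  count-fillHole {k} 1≤k k≤n rewrite count-↭ k (fillHole-↭ v A B) with <-cmp k v
  ... | tri< k<v _ _ rewrite ≡ᵇ-false (<⇒≢ k<v) =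
    trans (count-bump-< (A ++ B) k<v) (once 1≤k (≤-pred (≤-trans k<v v≤)))
  ... | tri≈ _ refl _ rewrite ≡ᵇ-refl k = cong suc (count-bump-≡ k (A ++ B))
  count-fillHole {suc k} 1≤k k≤n | tri> _ _ v<k rewrite ≡ᵇ-false (>⇒≢ v<k) =
    trans (count-bump-> (A ++ B) v<k) (once (≤-trans 1≤v (≤-pred v<k)) (≤-pred k≤n))

  fillHole-bounded : ∀ {x} → x ∈ fillHole v A B → x ∈ range1 n
  fillHole-bounded x∈ with ∈-resp-↭ (fillHole-↭ v A B) x∈
  ... | here refl = ∈-range1⁺ 1≤v v≤
  ... | there x∈′ with ∈-map⁻ (bump v) x∈′
  ... | y , y∈ , refl with bounded y∈ | y <? v
  ...   | 1≤y , y≤ | yes y<v = ∈-range1⁺ 1≤y (≤-trans y≤ (n≤1+n _))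
  ...   | 1≤y , y≤ | no  y≮v = ∈-range1⁺ (s≤s z≤n) (s≤s y≤)

  isPerm-fillHole : T (isPerm n (fillHole v A B))
  isPerm-fillHole = Equivalence.from T-∧
    ( ≡⇒≡ᵇ _ _ (length-fillHole v A B)
    , AllP.all⁻ _ (All.tabulate λ k∈ → let 1≤k , k≤n = ∈-range1⁻ k∈ in ≡⇒≡ᵇ _ _ (count-fillHole 1≤k k≤n)))

  fillHole-∈-perms : fillHole v A B ∈ perms n
  fillHole-∈-perms = ∈-filter⁺ (T? ∘ isPerm n)
    (∈-words⁺ (range1 n) n (length-fillHole v A B) (All.tabulate fillHole-bounded)) isPerm-fillHole

  isExtension-fillHole : T (isExtension (A ◇ B) (fillHole v A B))
  isExtension-fillHole rewrite length-◇ A B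
                             | restrictTo-◇ A B {map (bump v) A} {v} {map (bump v) B} (length-map _ A) (length-map _ B)
                             | filled-◇ A B
    = Equivalence.from T-∧ (isPerm-fillHole , subst (λ τ → T (st restricted ==L τ)) st≡ (==L-refl (st restricted)))
    where
    restricted : List ℕ
    restricted = map (bump v) A ++ map (bump v) B
    st≡ : st restricted ≡ A ++ B
    st≡ = trans (cong st (sym (map-++ (bump v) A B))) (trans (st-map-bump v (A ++ B)) (st-perm (A ++ B) perm))

∈-subseqs⁻ : ∀ {X : Set} {s : List X} xs → s ∈ subseqs xs → s ⊆ xs
∈-subseqs⁻ [] (here refl) = []
∈-subseqs⁻ (x ∷ xs) s∈ with ∈-++⁻ (map (x ∷_) (subseqs xs)) s∈
... | inj₂ s∈′ = x ∷ʳ ∈-subseqs⁻ xs s∈′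
... | inj₁ s∈′ with ∈-map⁻ (x ∷_) s∈′
... | s′ , s′∈ , refl = refl ∷ ∈-subseqs⁻ xs s′∈

∈-subseqs⁺ : ∀ {X : Set} {s : List X} xs → s ⊆ xs → s ∈ subseqs xs
∈-subseqs⁺ [] [] = here refl
∈-subseqs⁺ (x ∷ xs) (.x ∷ʳ s⊆) = ∈-++⁺ʳ (map (x ∷_) (subseqs xs)) (∈-subseqs⁺ xs s⊆)
∈-subseqs⁺ (x ∷ xs) (refl ∷ s⊆) = ∈-++⁺ˡ (∈-map⁺ (x ∷_) (∈-subseqs⁺ xs s⊆))

contains⁻ : ∀ p σ → T (contains p σ) → ∃[ s ] s ⊆ σ × length s ≡ length p × st s ≡ p
contains⁻ p σ t with find (AnyP.any⁻ _ (subseqs σ) t)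
... | s , s∈ , matches = let len , pat = Equivalence.to (T-∧ {length s ≡ᵇ length p}) matches in
  s , ∈-subseqs⁻ σ s∈ , ≡ᵇ⇒≡ _ _ len , ==L⇒≡ _ _ pat

contains⁺ : ∀ p {σ s} → s ⊆ σ → length s ≡ length p → st s ≡ p → T (contains p σ)
contains⁺ p {σ} {s} s⊆ len pat = AnyP.any⁺ _ (lose (∈-subseqs⁺ σ s⊆)
  (Equivalence.from T-∧ (≡⇒≡ᵇ _ _ len , subst (λ q → T (st s ==L q)) pat (==L-refl (st s)))))

-- Avoidance of 1234 and 1324
avoidsPartial⇒¬contains : ∀ p π {σ} → T (avoidsPartial p π) → σ ∈ perms (length π) →
                          T (isExtension π σ) → ¬ T (contains p σ)
avoidsPartial⇒¬contains p π {σ} avoids σ∈ =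
  not∨not (All.lookup (AllP.all⁺ _ (perms (length π)) avoids) σ∈)
  where
  not∨not : ∀ {b c} → T (not b ∨ not c) → T b → ¬ T c
  not∨not {true} {true} ()

p1234 p1324 : List ℕ
p1234 = 1 ∷ 2 ∷ 3 ∷ 4 ∷ []
p1324 = 1 ∷ 3 ∷ 2 ∷ 4 ∷ []

module _ (A B : List ℕ) (perm : IsPermutation (A ++ B)) where

  open IsPermutation perm

  private
    m = length (A ++ B)

    boundedA : ∀ {x} → x ∈ A → 1 ≤ x × x ≤ m
    boundedA = bounded ∘ ∈-++⁺ˡ

    boundedB : ∀ {x} → x ∈ B → 1 ≤ x × x ≤ m
    boundedB = bounded ∘ ∈-++⁺ʳ A

    hole-in-range : ∀ {x} → 1 ≤ x × x ≤ m → 1 ≤ x × x ≤ suc m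
    hole-in-range (1≤x , x≤m) = 1≤x , ≤-trans x≤m (n≤1+n m)

    top : 1 ≤ suc m × suc m ≤ suc m
    top = s≤s z≤n , ≤-refl

    bottom : 1 ≤ 1 × 1 ≤ suc m
    bottom = ≤-refl , s≤s z≤n

  fillHole-avoids : ∀ p → T (avoidsPartial p (A ◇ B)) →
                    ∀ {v} → 1 ≤ v × v ≤ suc m → ∀ {s} → s ⊆ fillHole v A B → st s ≢ p
  fillHole-avoids p avoids {v} (1≤v , v≤) {s} s⊆ pat =
    avoidsPartial⇒¬contains p (A ◇ B) avoids σ∈ (isExtension-fillHole A B perm 1≤v v≤) (contains⁺ p s⊆ len pat)
    where
    σ∈ : fillHole v A B ∈ perms (length (A ◇ B))
    σ∈ rewrite length-◇ A B = fillHole-∈-perms A B perm 1≤v v≤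
    len : length s ≡ length p
    len = trans (sym (length-map (λ x → suc (rank s x)) s)) (cong length pat)

  -- Each forbidden configuration becomes an occurrence of the pattern in the extension whose
  -- hole value lies above everything, below everything, or just below a value of the configuration.
  avoids⇒Avoids1234◇ : T (avoidsPartial p1234 (A ◇ B)) → Avoids1234◇ A B
  avoids⇒Avoids1234◇ avoids = ¬A , ¬B , ¬low , ¬asc
    where
    refute : ∀ {v} → 1 ≤ v × v ≤ suc m → ∀ {s} → s ⊆ fillHole v A B → st s ≢ p1234
    refute = fillHole-avoids p1234 avoids
    ¬A : ¬ Up.Has123 A
    ¬A (a , b , c , s , a<b , b<c) = refute top (⊆-fillHole (suc m) s (minimum B))
      (st4-1234⁺ (bump-mono-< _ a<b) (bump-mono-< _ b<c) (<-bump (s≤s (proj₂ (boundedA (head-∈ (⊆.∷ˡ⁻ (⊆.∷ˡ⁻ s))))))))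
    ¬B : ¬ Up.Has123 B
    ¬B (a , b , c , s , a<b , b<c) = refute bottom (⊆-fillHole 1 (minimum A) s)
      (st4-1234⁺ (>-bump (proj₁ (boundedB (head-∈ s)))) (bump-mono-< _ a<b) (bump-mono-< _ b<c))
    ¬low : ¬ LowBeforeAscent A B
    ¬low (x , y , x∈ , (z , s , y<z) , x<y) = refute (hole-in-range (boundedB (head-∈ s)))
      (⊆-fillHole y (from∈ x∈) s) (st4-1234⁺ (<-bump x<y) (>-bump ≤-refl) (bump-mono-< _ y<z))
    ¬asc : ¬ AscentBeforeHigh A B
    ¬asc (y , z , (x , s , x<y) , z∈ , y<z) = refute (hole-in-range (boundedB z∈))
      (⊆-fillHole z s (from∈ z∈)) (st4-1234⁺ (bump-mono-< _ x<y) (<-bump y<z) (>-bump ≤-refl))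

  avoids⇒Avoids1324◇ : T (avoidsPartial p1324 (A ◇ B)) → Avoids1324◇ A B
  avoids⇒Avoids1324◇ avoids = ¬A , ¬B , ¬low , ¬asc
    where
    refute : ∀ {v} → 1 ≤ v × v ≤ suc m → ∀ {s} → s ⊆ fillHole v A B → st s ≢ p1324
    refute = fillHole-avoids p1324 avoids
    ¬A : ¬ Up.Has132 A
    ¬A (a , b , c , s , a<c , c<b) = refute top (⊆-fillHole (suc m) s (minimum B))
      (st4-1324⁺ (bump-mono-< _ a<c) (bump-mono-< _ c<b) (<-bump (s≤s (proj₂ (boundedA (head-∈ (⊆.∷ˡ⁻ s)))))))
    ¬B : ¬ Has213 B
    ¬B (a , b , c , s , b<a , a<c) = refute bottom (⊆-fillHole 1 (minimum A) s)
      (st4-1324⁺ (>-bump (proj₁ (boundedB (head-∈ (⊆.∷ˡ⁻ s))))) (bump-mono-< _ b<a) (bump-mono-< _ a<c))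
    ¬low : ¬ LowBeforeAscent A B
    ¬low (x , y , x∈ , (z , s , y<z) , x<y) = refute (hole-in-range (boundedB (head-∈ (⊆.∷ˡ⁻ s))))
      (⊆-fillHole z (from∈ x∈) s) (st4-1324⁺ (bump-mono-< _ x<y) (<-bump y<z) (>-bump ≤-refl))
    ¬asc : ¬ AscentBeforeHigh A B
    ¬asc (y , z , (x , s , x<y) , z∈ , y<z) = refute (hole-in-range (boundedA (head-∈ (⊆.∷ˡ⁻ s))))
      (⊆-fillHole y s (from∈ z∈)) (st4-1324⁺ (<-bump x<y) (>-bump ≤-refl) (bump-mono-< _ y<z))

length-∈-perms : ∀ {n σ} → σ ∈ perms n → length σ ≡ n
length-∈-perms σ∈ = proj₁ (∈-words⁻ _ _ (proj₁ (∈-filter⁻ (T? ∘ isPerm _) σ∈)))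

-- Every extension of A ◇ B has the form A' ++ v ∷ B' with st (A' ++ B') ≡ A ++ B.
avoidsPartial-◇ : ∀ p A B →
  (∀ {A' v B' s} → length A' ≡ length A → st (A' ++ B') ≡ A ++ B →
     s ⊆ A' ++ v ∷ B' → length s ≡ length p → st s ≢ p) →
  T (avoidsPartial p (A ◇ B))
avoidsPartial-◇ p A B free = AllP.all⁻ _ (All.tabulate check)
  where
  violated : ∀ {σ} → σ ∈ perms (length (A ◇ B)) → T (isExtension (A ◇ B) σ) → T (contains p σ) → ⊥
  violated {σ} σ∈ ext has
    with split-at-hole A B σ (trans (length-∈-perms σ∈) (trans (length-◇ A B) (cong suc (length-++ A))))
  ... | A' , v , B' , refl , lenA , lenB = let s , s⊆ , len , pat = contains⁻ p σ has in free lenA st≡ s⊆ len pat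
    where
    st≡ : st (A' ++ B') ≡ A ++ B
    st≡ = begin
      st (A' ++ B')                          ≡⟨ cong st (restrictTo-◇ A B lenA lenB) ⟨
      st (restrictTo (A ◇ B) (A' ++ v ∷ B')) ≡⟨ ==L⇒≡ _ _ (proj₂ (Equivalence.to (T-∧ {isPerm _ (A' ++ v ∷ B')}) ext)) ⟩
      filled (A ◇ B)                         ≡⟨ filled-◇ A B ⟩
      A ++ B                                 ∎
      where open ≡-Reasoning

  check : ∀ {σ} → σ ∈ perms (length (A ◇ B)) → T (not (isExtension (A ◇ B) σ) ∨ avoidsPerm p σ)
  check {σ} σ∈ with isExtension (A ◇ B) σ in ext | contains p σ in has
  ... | false | _     = tt
  ... | true  | false = tt
  ... | true  | true  = violated σ∈ (subst T (sym ext) tt) (subst T (sym has) tt)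

-- How an occurrence w x y z in A' ++ v ∷ B' meets the two sides (v itself is forgotten).
data Placement (w x y z : ℕ) (A' B' : List ℕ) : Set where
  first3-left     : (w ∷ x ∷ y ∷ []) ⊆ A' → Placement w x y z A' B'
  first2-left     : (w ∷ x ∷ []) ⊆ A' → z ∈ B' → Placement w x y z A' B'
  first-left      : w ∈ A' → (x ∷ y ∷ z ∷ []) ⊆ B' → Placement w x y z A' B'
  first-left-hole : w ∈ A' → (y ∷ z ∷ []) ⊆ B' → Placement w x y z A' B'
  last3-right     : (x ∷ y ∷ z ∷ []) ⊆ B' → Placement w x y z A' B'

placement : ∀ {w x y z} A' v B' → (w ∷ x ∷ y ∷ z ∷ []) ⊆ A' ++ v ∷ B' → Placement w x y z A' B'
placement A' v B' s⊆ with ⊆-++-split A' (v ∷ B') s⊆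
... | [] , _ , refl , _ , _ ∷ʳ s₂                        = last3-right (⊆.∷ˡ⁻ s₂)
... | [] , _ , refl , _ , refl ∷ s₂                      = last3-right s₂
... | _ ∷ [] , _ , refl , s₁ , _ ∷ʳ s₂                   = first-left (head-∈ s₁) s₂
... | _ ∷ [] , _ , refl , s₁ , refl ∷ s₂                 = first-left-hole (head-∈ s₁) s₂
... | _ ∷ _ ∷ [] , _ , refl , s₁ , _ ∷ʳ s₂              = first2-left s₁ (head-∈ (⊆.∷ˡ⁻ s₂))
... | _ ∷ _ ∷ [] , _ , refl , s₁ , refl ∷ s₂            = first2-left s₁ (head-∈ s₂)
... | _ ∷ _ ∷ _ ∷ [] , _ , refl , s₁ , _                 = first3-left s₁
... | _ ∷ _ ∷ _ ∷ d ∷ [] , _ , refl , s₁ , _             = first3-left (⊆-trans (refl ∷ refl ∷ refl ∷ d ∷ʳ []) s₁)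

module Standardise {A B A' B' : List ℕ} (lenA : length A' ≡ length A) (st≡ : st (A' ++ B') ≡ A ++ B) where

  f : ℕ → ℕ
  f u = suc (rank (A' ++ B') u)

  private
    split : map f A' ≡ A × map f B' ≡ B
    split = ++-injective (map f A') A (trans (length-map f A') lenA) (trans (sym (map-++ f A' B')) st≡)

  f-⊆ˡ : ∀ {s} → s ⊆ A' → map f s ⊆ A
  f-⊆ˡ {s} s⊆ = subst (map f s ⊆_) (proj₁ split) (⊆.map⁺ f s⊆)

  f-⊆ʳ : ∀ {s} → s ⊆ B' → map f s ⊆ B
  f-⊆ʳ {s} s⊆ = subst (map f s ⊆_) (proj₂ split) (⊆.map⁺ f s⊆)

  f-∈ˡ : ∀ {u} → u ∈ A' → f u ∈ A
  f-∈ˡ = head-∈ ∘ f-⊆ˡ ∘ from∈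

  f-∈ʳ : ∀ {u} → u ∈ B' → f u ∈ B
  f-∈ʳ = head-∈ ∘ f-⊆ʳ ∘ from∈

  f-<ˡ : ∀ {u u'} → u ∈ A' → u < u' → f u < f u'
  f-<ˡ u∈ u<u' = s≤s (rank-strict (A' ++ B') (∈-++⁺ˡ u∈) u<u')

  f-<ʳ : ∀ {u u'} → u ∈ B' → u < u' → f u < f u'
  f-<ʳ u∈ u<u' = s≤s (rank-strict (A' ++ B') (∈-++⁺ʳ A' u∈) u<u')

module _ {A B A' B' : List ℕ} (lenA : length A' ≡ length A) (st≡ : st (A' ++ B') ≡ A ++ B) where

  open Standardise {A} {B} {A'} {B'} lenA st≡

  ¬1234-placement : Avoids1234◇ A B → ∀ {w x y z} → w < x → x < y → y < z → ¬ Placement w x y z A' B'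
  ¬1234-placement (¬A , _ , _ , _) {w} {x} {y} w<x x<y _ (first3-left s) =
    ¬A (f w , f x , f y , f-⊆ˡ s , f-<ˡ (head-∈ s) w<x , f-<ˡ (head-∈ (⊆.∷ˡ⁻ s)) x<y)
  ¬1234-placement (_ , _ , _ , ¬asc) {w} {x} {y} {z} w<x x<y y<z (first2-left s z∈) =
    ¬asc (f x , f z , (f w , f-⊆ˡ s , f-<ˡ (head-∈ s) w<x) , f-∈ʳ z∈ , f-<ˡ (head-∈ (⊆.∷ˡ⁻ s)) (<-trans x<y y<z))
  ¬1234-placement (_ , _ , ¬low , _) {w} {x} {y} {z} w<x x<y _ (first-left w∈ s) =
    ¬low (f w , f x , f-∈ˡ w∈ , (f y , f-⊆ʳ (⊆-trans (refl ∷ refl ∷ z ∷ʳ []) s) , f-<ʳ (head-∈ s) x<y) , f-<ˡ w∈ w<x)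
  ¬1234-placement (_ , _ , ¬low , _) {w} {x} {y} {z} w<x x<y y<z (first-left-hole w∈ s) =
    ¬low (f w , f y , f-∈ˡ w∈ , (f z , f-⊆ʳ s , f-<ʳ (head-∈ s) y<z) , f-<ˡ w∈ (<-trans w<x x<y))
  ¬1234-placement (_ , ¬B , _ , _) {w} {x} {y} {z} _ x<y y<z (last3-right s) =
    ¬B (f x , f y , f z , f-⊆ʳ s , f-<ʳ (head-∈ s) x<y , f-<ʳ (head-∈ (⊆.∷ˡ⁻ s)) y<z)

  ¬1324-placement : Avoids1324◇ A B → ∀ {w x y z} → w < y → y < x → x < z → ¬ Placement w x y z A' B'
  ¬1324-placement (¬A , _ , _ , _) {w} {x} {y} w<y y<x _ (first3-left s) =
    ¬A (f w , f x , f y , f-⊆ˡ s , f-<ˡ (head-∈ s) w<y , f-<ˡ (head-∈ (⊆.∷ˡ⁻ (⊆.∷ˡ⁻ s))) y<x)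
  ¬1324-placement (_ , _ , _ , ¬asc) {w} {x} {y} {z} w<y y<x x<z (first2-left s z∈) =
    ¬asc (f x , f z , (f w , f-⊆ˡ s , f-<ˡ (head-∈ s) (<-trans w<y y<x)) , f-∈ʳ z∈ , f-<ˡ (head-∈ (⊆.∷ˡ⁻ s)) x<z)
  ¬1324-placement (_ , ¬B , _ , _) {w} {x} {y} {z} _ y<x x<z (first-left _ s) =
    ¬B (f x , f y , f z , f-⊆ʳ s , f-<ʳ (head-∈ (⊆.∷ˡ⁻ s)) y<x , f-<ʳ (head-∈ s) x<z)
  ¬1324-placement (_ , _ , ¬low , _) {w} {x} {y} {z} w<y y<x x<z (first-left-hole w∈ s) =
    ¬low (f w , f y , f-∈ˡ w∈ , (f z , f-⊆ʳ s , f-<ʳ (head-∈ s) (<-trans y<x x<z)) , f-<ˡ w∈ w<y)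
  ¬1324-placement (_ , ¬B , _ , _) {w} {x} {y} {z} _ y<x x<z (last3-right s) =
    ¬B (f x , f y , f z , f-⊆ʳ s , f-<ʳ (head-∈ (⊆.∷ˡ⁻ s)) y<x , f-<ʳ (head-∈ s) x<z)

Avoids1234◇⇒avoids : ∀ A B → Avoids1234◇ A B → T (avoidsPartial p1234 (A ◇ B))
Avoids1234◇⇒avoids A B avoids = avoidsPartial-◇ p1234 A B free
  where
  free : ∀ {A' v B' s} → length A' ≡ length A → st (A' ++ B') ≡ A ++ B →
         s ⊆ A' ++ v ∷ B' → length s ≡ 4 → st s ≢ p1234
  free {A'} {v} {B'} {w ∷ x ∷ y ∷ z ∷ []} lenA st≡ s⊆ refl pat =
    let w<x , x<y , y<z = st4-1234⁻ pat in ¬1234-placement lenA st≡ avoids w<x x<y y<z (placement A' v B' s⊆)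

Avoids1324◇⇒avoids : ∀ A B → Avoids1324◇ A B → T (avoidsPartial p1324 (A ◇ B))
Avoids1324◇⇒avoids A B avoids = avoidsPartial-◇ p1324 A B free
  where
  free : ∀ {A' v B' s} → length A' ≡ length A → st (A' ++ B') ≡ A ++ B →
         s ⊆ A' ++ v ∷ B' → length s ≡ 4 → st s ≢ p1324
  free {A'} {v} {B'} {w ∷ x ∷ y ∷ z ∷ []} lenA st≡ s⊆ refl pat =
    let w<y , y<x , x<z = st4-1324⁻ pat in ¬1324-placement lenA st≡ avoids w<y y<x x<z (placement A' v B' s⊆)

Unique-⊆-length : ∀ {X : Set} (xs ys : List X) → Unique xs → (∀ {x} → x ∈ xs → x ∈ ys) →
                  length xs ≤ length ys
Unique-⊆-length [] ys _ _ = z≤n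
Unique-⊆-length (x ∷ xs) ys (x∉xs ∷ uxs) xs⊆ys with ∈-∃++ (xs⊆ys (here refl))
... | ys₁ , ys₂ , refl = ≤-trans (s≤s (Unique-⊆-length xs (ys₁ ++ ys₂) uxs xs⊆ys₁ys₂))
                                 (≤-reflexive (sym (length-++-sucʳ ys₁ x ys₂)))
  where
  xs⊆ys₁ys₂ : ∀ {z} → z ∈ xs → z ∈ ys₁ ++ ys₂
  xs⊆ys₁ys₂ z∈ with ∈-++⁻ ys₁ (xs⊆ys (there z∈))
  ... | inj₁ z∈ys₁           = ∈-++⁺ˡ z∈ys₁
  ... | inj₂ (here refl)     = ⊥-elim (All.lookup x∉xs z∈ refl)
  ... | inj₂ (there z∈ys₂)   = ∈-++⁺ʳ ys₁ z∈ys₂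

length-filterᵇ-≤ : ∀ {X : Set} (L : List X) → Unique L → (F G : X → Bool) (Φ Ψ : X → X) →
                   (∀ {x} → x ∈ L → T (F x) → Φ x ∈ L × T (G (Φ x))) →
                   (∀ {x} → x ∈ L → T (F x) → Ψ (Φ x) ≡ x) →
                   length (filterᵇ F L) ≤ length (filterᵇ G L)
length-filterᵇ-≤ L uL F G Φ Ψ Φ-into Ψ∘Φ =
  subst (_≤ length (filterᵇ G L)) (length-map Φ (filterᵇ F L))
    (Unique-⊆-length (map Φ (filterᵇ F L)) (filterᵇ G L) uΦ image⊆)
  where
  uΦ : Unique (map Φ (filterᵇ F L))
  uΦ = Unique.map⁻ {f = Ψ} (subst Unique (sym Ψ∘Φ-id) (Unique.filter⁺ (T? ∘ F) uL))
    where
    Ψ∘Φ-id : map Ψ (map Φ (filterᵇ F L)) ≡ filterᵇ F L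
    Ψ∘Φ-id = trans (sym (map-∘ (filterᵇ F L)))
                   (map-id-local (All.tabulate λ x∈ → let x∈L , Fx = ∈-filter⁻ (T? ∘ F) x∈ in Ψ∘Φ x∈L Fx))
  image⊆ : ∀ {y} → y ∈ map Φ (filterᵇ F L) → y ∈ filterᵇ G L
  image⊆ y∈ with ∈-map⁻ Φ y∈
  ... | x , x∈ , refl = let x∈L , Fx = ∈-filter⁻ (T? ∘ F) x∈ ; Φx∈L , GΦx = Φ-into x∈L Fx in
    ∈-filter⁺ (T? ∘ G) Φx∈L GΦx

∈-partialPerms1⁻ : ∀ {n π} → π ∈ partialPerms1 n →
                   π ∈ words (nothing ∷ map just (range1 (n ∸ 1))) n ×
                   length π ≡ n × occ eqM nothing π ≡ 1 × (∀ {k} → k ∈ range1 (n ∸ 1) → occ eqM (just k) π ≡ 1)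
∈-partialPerms1⁻ {n} {π} π∈ with ∈-filter⁻ (T? ∘ isPartialPerm1 n) {xs = words _ n} π∈
... | π∈words , partial with Equivalence.to T-∧ partial
... | len , rest with Equivalence.to (T-∧ {occ eqM nothing π ≡ᵇ 1}) rest
... | one-hole , each =
  π∈words , ≡ᵇ⇒≡ _ _ len , ≡ᵇ⇒≡ _ _ one-hole , λ k∈ → ≡ᵇ⇒≡ _ _ (All.lookup (AllP.all⁺ _ _ each) k∈)

record Decomposition (j : ℕ) (π : PWord) : Set where
  field
    left right : List ℕ
    ◇≡         : left ◇ right ≡ π
    hole       : j ≡ suc (length left)
    perm       : IsPermutation (left ++ right)

decompose : ∀ {n j π} → π ∈ partialPerms1 n → T (holeAt j π) → Decomposition j π
decompose {n} {j} {π} π∈ hole with ∈-partialPerms1⁻ {n} π∈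
... | π∈words , len , one-hole , each = record { left = A ; right = B ; ◇≡ = ◇≡ ; hole = j≡ ; perm = perm }
  where
  A B : List ℕ
  A = proj₁ (split◇ π)
  B = proj₂ (split◇ π)
  ◇≡ : A ◇ B ≡ π
  ◇≡ = ◇-split◇ π one-hole
  j≡ : j ≡ suc (length A)
  j≡ = holeAt-◇⁻ j A B (subst (T ∘ holeAt j) (sym ◇≡) hole)
  n∸1≡ : n ∸ 1 ≡ length (A ++ B)
  n∸1≡ = cong (_∸ 1) (trans (sym len) (trans (cong length (sym ◇≡)) (length-◇ A B)))
  just∈π : ∀ {x} → x ∈ A ++ B → just x ∈ π
  just∈π x∈ with ∈-++⁻ A x∈
  ... | inj₁ x∈A = subst (just _ ∈_) ◇≡ (∈-++⁺ˡ (∈-map⁺ just x∈A))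
  ... | inj₂ x∈B = subst (just _ ∈_) ◇≡ (∈-++⁺ʳ (map just A) (there (∈-map⁺ just x∈B)))
  bounded : ∀ {x} → x ∈ A ++ B → 1 ≤ x × x ≤ length (A ++ B)
  bounded x∈ with All.lookup (proj₂ (∈-words⁻ _ n π∈words)) (just∈π x∈)
  ... | there jx∈ with ∈-map⁻ just jx∈
  ... | _ , x∈range , refl = ∈-range1⁻ (subst (λ m → _ ∈ range1 m) n∸1≡ x∈range)
  once : ∀ {k} → 1 ≤ k → k ≤ length (A ++ B) → count k (A ++ B) ≡ 1
  once {k} 1≤k k≤ = begin
    count k (A ++ B)        ≡⟨ count-just-◇ k A B ⟨
    occ eqM (just k) (A ◇ B) ≡⟨ cong (occ eqM (just k)) ◇≡ ⟩
    occ eqM (just k) π       ≡⟨ each (subst (λ m → k ∈ range1 m) (sym n∸1≡) (∈-range1⁺ 1≤k k≤)) ⟩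
    1                        ∎
    where open ≡-Reasoning
  perm : IsPermutation (A ++ B)
  perm = record { bounded = bounded ; once = once }

isPartialPerm1-↭ : ∀ n {π π'} → π ↭ π' → isPartialPerm1 n π ≡ isPartialPerm1 n π'
isPartialPerm1-↭ n {π} {π'} r = cong₂ _∧_ (cong (_≡ᵇ n) (↭-length r))
  (cong₂ _∧_ (cong (_≡ᵇ 1) (occ-↭ nothing)) (all-cong (range1 (n ∸ 1)) λ k → cong (_≡ᵇ 1) (occ-↭ (just k))))
  where
  occ-↭ : ∀ a → occ eqM a π ≡ occ eqM a π'
  occ-↭ a = ↭-length (filter-↭ (T? ∘ eqM a) r)
  all-cong : ∀ ks {p q : ℕ → Bool} → (∀ k → p k ≡ q k) → all p ks ≡ all q ks
  all-cong [] _ = refl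
  all-cong (k ∷ ks) p≡q = cong₂ _∧_ (p≡q k) (all-cong ks p≡q)

◇-↭ : ∀ {A A' B B'} → A' ↭ A → B' ↭ B → A' ◇ B' ↭ A ◇ B
◇-↭ rA rB = ↭.++⁺ (↭.map⁺ just rA) (prep nothing (↭.map⁺ just rB))

rearranged-∈ : ∀ {n π A B A' B'} → π ∈ partialPerms1 n → A ◇ B ≡ π → A' ↭ A → B' ↭ B → A' ◇ B' ∈ partialPerms1 n
rearranged-∈ {n} {π} {A' = A'} {B'} π∈ refl rA rB =
  ∈-filter⁺ (T? ∘ isPartialPerm1 n)
    (∈-words⁺ _ n (trans (↭-length r) (proj₁ π-word)) (All-resp-↭ (↭-sym r) (proj₂ π-word)))
    (subst T (sym (isPartialPerm1-↭ n r)) (proj₂ π∈filter))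
  where
  r : A' ◇ B' ↭ π
  r = ◇-↭ rA rB
  π∈filter : π ∈ words (nothing ∷ map just (range1 (n ∸ 1))) n × T (isPartialPerm1 n π)
  π∈filter = ∈-filter⁻ (T? ∘ isPartialPerm1 n) {xs = words _ n} π∈
  π-word : length π ≡ n × All (_∈ nothing ∷ map just (range1 (n ∸ 1))) π
  π-word = ∈-words⁻ _ n (proj₁ π∈filter)

module _ {p q : List ℕ} {Good-p Good-q : List ℕ → List ℕ → Set}
         (avoids⇒Good : ∀ A B → IsPermutation (A ++ B) → T (avoidsPartial p (A ◇ B)) → Good-p A B)
         (Good⇒avoids : ∀ A B → Good-q A B → T (avoidsPartial q (A ◇ B)))
         (fA fB gA gB : List ℕ → List ℕ)
         (fA-↭ : ∀ A → fA A ↭ A) (fB-↭ : ∀ B → fB B ↭ B)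
         (f-Good : ∀ A B → Good-p A B → Good-q (fA A) (fB B))
         (g∘f : ∀ A B → Good-p A B → gA (fA A) ≡ A × gB (fB B) ≡ B) where

  count1-≤ : ∀ n j → count1 p n j ≤ count1 q n j
  count1-≤ n j =
    length-filterᵇ-≤ (partialPerms1 n) (partialPerms1-unique n) (counted p) (counted q) Φ Ψ Φ-into Ψ∘Φ
    where
    counted : List ℕ → PWord → Bool
    counted r π = holeAt j π ∧ avoidsPartial r π

    Φ Ψ : PWord → PWord
    Φ π = fA (proj₁ (split◇ π)) ◇ fB (proj₂ (split◇ π))
    Ψ π = gA (proj₁ (split◇ π)) ◇ gB (proj₂ (split◇ π))

    module _ {π} (π∈ : π ∈ partialPerms1 n) (t : T (counted p π)) where

      open Decomposition (decompose {n} π∈ (proj₁ (Equivalence.to T-∧ t))) renaming (left to A; right to B)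

      good : Good-p A B
      good = avoids⇒Good A B perm (subst (T ∘ avoidsPartial p) (sym ◇≡) (proj₂ (Equivalence.to T-∧ t)))

      Φ≡ : Φ π ≡ fA A ◇ fB B
      Φ≡ = cong (λ AB → fA (proj₁ AB) ◇ fB (proj₂ AB)) (trans (cong split◇ (sym ◇≡)) (split◇-◇ A B))

      Φ-into : Φ π ∈ partialPerms1 n × T (counted q (Φ π))
      Φ-into rewrite Φ≡ =
        rearranged-∈ {n} π∈ ◇≡ (fA-↭ A) (fB-↭ B) ,
        Equivalence.from T-∧ (holeAt-◇-length A (fA A) (fB B) hole (↭-length (fA-↭ A)) , Good⇒avoids _ _ (f-Good A B good))

      Ψ∘Φ : Ψ (Φ π) ≡ π
      Ψ∘Φ rewrite Φ≡ | split◇-◇ (fA A) (fB B) =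
        trans (cong₂ _◇_ (proj₁ (g∘f A B good)) (proj₂ (g∘f A B good))) ◇≡

count1-1234≤1324 : ∀ n j → count1 p1234 n j ≤ count1 p1324 n j
count1-1234≤1324 = count1-≤ avoids⇒Avoids1234◇ Avoids1324◇⇒avoids
  Up.To132.reshape (mirror Down.To132.reshape) Up.To123.reshape (mirror Down.To123.reshape)
  Up.To132.reshape-↭ (mirror-↭ Down.To132.reshape-↭) to1324◇-avoids to1234◇∘to1324◇

count1-1324≤1234 : ∀ n j → count1 p1324 n j ≤ count1 p1234 n j
count1-1324≤1234 = count1-≤ avoids⇒Avoids1324◇ Avoids1234◇⇒avoids
  Up.To123.reshape (mirror Down.To123.reshape) Up.To132.reshape (mirror Down.To132.reshape)
  Up.To123.reshape-↭ (mirror-↭ Down.To123.reshape-↭) to1234◇-avoids to1324◇∘to1234◇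

proposition27 : (n j : ℕ) → 1 ≤ n → 1 ≤ j → j ≤ n →
    count1 (1 ∷ 2 ∷ 3 ∷ 4 ∷ []) n j ≡ count1 (1 ∷ 3 ∷ 2 ∷ 4 ∷ []) n j
proposition27 n j _ _ _ = ≤-antisym (count1-1234≤1324 n j) (count1-1324≤1234 n j)
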